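{- If $n\ge3$, then the average number of occurrences of $123$-subwords in $\mathrm{Flatten}(\pi)$, taken over all $\pi\in\mathcal S_n$, equals $\frac{n^2+3n-6}{6n}$.
   Context: $\mathcal S_n$ is the set of permutations of $[n]$. For $\pi\in\mathcal S_n$ written in standard cycle form (each cycle begins with its smallest element, cycles ordered left to right by increasing smallest elements), $\mathrm{Flatten}(\pi)$ is the word obtained by erasing the parentheses. An occurrence of a $123$-subword in a word $w$ is an index $i$ with $w_i<w_{i+1}<w_{i+2}$. -}

module Defs where

open import Data.Nat using (ℕ; zero; suc; _+_; _<ᵇ_; _≤ᵇ_)
open import Data.Bool using (Bool; true; false; if_then_else_; _∧_)
open import Data.Fin using (Fin; toℕ)
open import Data.Fin.Properties using (_≟_)
open import Data.List using (List; []; _∷_; _++_; map; concat; concatMap; filter; allFin; length)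
open import Data.Nat.ListAction using (sum)
open import Data.List.Relation.Unary.All using (All)
open import Data.List.Membership.Propositional using (_∈_)
open import Data.Fin.Permutation using (Permutation′; _⟨$⟩ʳ_)
open import Relation.Nullary using (does; ¬_)
open import Data.List.Relation.Unary.Any using (Any)
open import Data.List.Relation.Unary.AllPairs using (AllPairs)
open import Relation.Binary.PropositionalEquality using (_≡_)
open import Data.Product using (_×_; Σ; ∃)

-- Permutations of [n] are modelled as bijections Fin n ↔ Fin n, with the
-- value i : Fin n standing for the element i+1 of [n] (order-preserving).

-- π-orbit of m, starting at m and stopping just before returning to m
-- (fuel k bounds the length; with k = n it is the whole cycle).
orbitFrom : ∀ {n} → (Fin n → Fin n) → Fin n → ℕ → Fin n → List (Fin n)
orbitFrom f m zero    c = []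
orbitFrom f m (suc k) c with does (c ≟ m)
... | true  = []
... | false = c ∷ orbitFrom f m k (f c)

cycleOf : ∀ {n} → Permutation′ n → Fin n → List (Fin n)
cycleOf {n} π m = m ∷ orbitFrom (π ⟨$⟩ʳ_) m n (π ⟨$⟩ʳ m)

allGeq : ∀ {n} → Fin n → List (Fin n) → Bool
allGeq m []       = true
allGeq m (x ∷ xs) = (toℕ m ≤ᵇ toℕ x) ∧ allGeq m xs

isCycleMin : ∀ {n} → Permutation′ n → Fin n → Bool
isCycleMin π m = allGeq m (cycleOf π m)

-- Standard cycle form: cycles begin with their smallest element and are
-- listed by increasing smallest element; Flatten erases the parentheses.
flatten : ∀ {n} → Permutation′ n → List ℕ
flatten {n} π =
  map toℕ (concatMap (cycleOf π) (filter (λ m → Data.Bool._≟_ (isCycleMin π m) true) (allFin n)))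

occ123 : List ℕ → ℕ
occ123 (a ∷ b ∷ c ∷ w) = (if (a <ᵇ b) ∧ (b <ᵇ c) then 1 else 0) + occ123 (b ∷ c ∷ w)
occ123 _ = 0

_≈ₚ_ : ∀ {n} → Permutation′ n → Permutation′ n → Set
π ≈ₚ σ = ∀ i → π ⟨$⟩ʳ i ≡ σ ⟨$⟩ʳ i

IsEnumeration : ∀ n → List (Permutation′ n) → Set
IsEnumeration n L = (∀ (π : Permutation′ n) → Any (π ≈ₚ_) L)
                  × AllPairs (λ σ τ → ¬ (σ ≈ₚ τ)) L

total123 : ∀ {n} → List (Permutation′ n) → ℕ
total123 L = sum (map (λ π → occ123 (flatten π)) L)

-- Every permutation of [n + 1] arises exactly once from a permutation g of [n] and a point s of [n + 1]
-- by inserting n + 1 right after s in its g-cycle, or as a new fixed point when s = n + 1.  In standard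
-- cycle form this puts the largest letter right after s in Flatten(g), resp. appends it.  Summing a
-- statistic over the n + 1 insertions of a new largest letter gives recurrences for its total over S_n;
-- for the numbers T of 123-occurrences, A of ascents and B of final ascents,
--   T(n+1) = (n - 1) T(n) + A(n) + B(n),   A(n+1) = n A(n) + (n + 1)!,   B(n+1) = (n - 2) B(n) + 2 n!,
-- solved for n ≥ 3 by 3 B(n) = 2 n!, 2n A(n) = n! (n - 1)(n + 2) and 6n T(n) = n! (n² + 3n - 6).
module Submission where

open import Defs

open import Data.Bool using (Bool; true; false; if_then_else_; _∧_; T) renaming (_≟_ to _≟ᵇ_)
open import Data.Bool.Properties using (∧-zeroʳ; ∧-identityʳ; T-≡)
open import Data.Empty using (⊥-elim)
open import Data.Fin using (Fin; zero; suc; toℕ; fromℕ; inject₁; punchIn)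
open import Data.Fin.Permutation
  using (Permutation′; _⟨$⟩ʳ_; _⟨$⟩ˡ_; inverseˡ; inverseʳ; _∘ₚ_; transpose; insert; remove; insert-punchIn; insert-remove)
  renaming (id to idₚ)
import Data.Fin.Permutation.Components as PC
open import Data.Fin.Properties
  using (toℕ-injective; toℕ<n; toℕ-inject₁; toℕ-fromℕ; fromℕ≢inject₁; inject₁-injective; pigeonhole)
  renaming (_≟_ to _≟ᶠ_)
open import Data.List using (List; []; _∷_; _++_; [_]; length; map; concat; concatMap; filter; tabulate; allFin)
import Data.List as List
open import Data.List.Membership.Propositional using (_∈_)
open import Data.List.Membership.Propositional.Properties using (∈-map⁺; ∈-allFin)
open import Data.List.Properties
  using ( ++-identityʳ; concat-map; concatMap-++; concatMap-cong; concatMap-map; filter-++; filter-accept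
        ; filter-reject; filter-≐; length-map; length-tabulate; map-++; map-cong; map-cong-local; map-tabulate; map-∘)
open import Data.List.Relation.Binary.Permutation.Propositional
  using (_↭_; ↭-refl; ↭-prep; ↭-swap; ↭-sym; ↭-trans; ↭⇒↭ₛ; module PermutationReasoning)
open import Data.List.Relation.Binary.Permutation.Propositional.Properties
  using (∷↭∷ʳ; ∈-resp-↭; ++⁺ʳ; ↭-length; All-resp-↭; Any-resp-↭)
import Data.List.Relation.Binary.Permutation.Propositional.Properties as Permutation
import Data.List.Relation.Binary.Permutation.Setoid.Properties as PermutationSetoid
open import Data.List.Relation.Unary.All as All using (All; []; _∷_)
import Data.List.Relation.Unary.All.Properties as All
open import Data.List.Relation.Unary.All.Properties using (++⁻ʳ; All¬⇒¬Any)
open import Data.List.Relation.Unary.AllPairs as AllPairs using (AllPairs; []; _∷_)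
import Data.List.Relation.Unary.AllPairs.Properties as AllPairs
open import Data.List.Relation.Unary.Any as Any using (Any; here; there)
import Data.List.Relation.Unary.Any.Properties as Any
open import Data.List.Relation.Unary.Unique.Propositional using (Unique)
import Data.List.Relation.Unary.Unique.Propositional.Properties as Unique
open import Data.Nat using (ℕ; zero; suc; _+_; _*_; _∸_; _!; _≤_; _<_; _<ᵇ_; _≤ᵇ_; z≤n; s≤s)
open import Data.Nat.GeneralisedArithmetic using (iterate)
open import Data.Nat.ListAction using (sum)
open import Data.Nat.ListAction.Properties using (sum-++; sum-↭)
open import Data.Nat.Properties
  using ( *-assoc; *-comm; *-identityˡ; +-assoc; +-cancelʳ-≡; +-comm; +-identityʳ; 1+n≰n; <⇒<ᵇ; <⇒≤; <⇒≱; _≟_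
        ; m+[n∸m]≡n; m+n∸m≡n; m∸n≤m; m≤n⇒m≤1+n; n<1+n; n≤1+n; ≤-pred; ≤-refl; ≤-reflexive; ≤-trans; ≤ᵇ⇒≤; ≤⇒≤ᵇ)
open import Data.Nat.Tactic.RingSolver using (solve-∀)
open import Data.Product using (∃-syntax; _×_; _,_; proj₁; proj₂)
open import Function using (_∘_; id; case_of_; Injective; Equivalence)
open import Relation.Binary.Definitions using (DecidableEquality)
open import Relation.Binary.PropositionalEquality
  using (_≡_; _≢_; refl; sym; trans; cong; cong₂; subst; resp₂; ≢-sym; module ≡-Reasoning)
open import Relation.Binary.PropositionalEquality.Properties using (setoid)
open import Relation.Binary.Structures using (IsEquivalence)
open import Relation.Nullary using (¬_; Dec; does; yes; no)
open import Relation.Nullary.Decidable using (dec-true; dec-false)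
open import Relation.Unary using (Decidable)

module _ {A : Set} where

  sum-map-+ : ∀ (f g : A → ℕ) xs → sum (map (λ x → f x + g x) xs) ≡ sum (map f xs) + sum (map g xs)
  sum-map-+ f g []       = refl
  sum-map-+ f g (x ∷ xs) = trans (cong (f x + g x +_) (sum-map-+ f g xs)) (interchange (f x) (g x) _ _)
    where
    interchange : ∀ a b c d → a + b + (c + d) ≡ a + c + (b + d)
    interchange = solve-∀

  sum-map-const : ∀ k (xs : List A) → sum (map (λ _ → k) xs) ≡ length xs * k
  sum-map-const k []       = refl
  sum-map-const k (x ∷ xs) = cong (k +_) (sum-map-const k xs)

  length≡sum-map-1 : ∀ (xs : List A) → length xs ≡ sum (map (λ _ → 1) xs)
  length≡sum-map-1 []       = refl
  length≡sum-map-1 (x ∷ xs) = cong suc (length≡sum-map-1 xs)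

  sum-map-concatMap : ∀ {B : Set} (k : B → ℕ) (f : A → List B) xs →
    sum (map k (concatMap f xs)) ≡ sum (map (λ x → sum (map k (f x))) xs)
  sum-map-concatMap k f []       = refl
  sum-map-concatMap k f (x ∷ xs) =
    trans (cong sum (map-++ k (f x) (concatMap f xs)))
          (trans (sum-++ (map k (f x)) _) (cong (sum (map k (f x)) +_) (sum-map-concatMap k f xs)))

  sum-map-cong-All : ∀ {f g : A → ℕ} {xs} → All (λ x → f x ≡ g x) xs → sum (map f xs) ≡ sum (map g xs)
  sum-map-cong-All eqs = cong sum (map-cong-local eqs)

sum-map-affine : ∀ {A : Set} {F H R : A → ℕ} c k {xs} → All (λ x → F x + c * H x ≡ k * H x + R x) xs →
  sum (map F xs) + c * sum (map H xs) ≡ k * sum (map H xs) + sum (map R xs)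
sum-map-affine c k [] = vanish c k
  where
  vanish : ∀ c k → 0 + c * 0 ≡ k * 0 + 0
  vanish = solve-∀
sum-map-affine {F = F} {H} {R} c k {x ∷ xs} (eq ∷ eqs) = begin
  F x + ΣF + c * (H x + ΣH)            ≡⟨ regroup (F x) ΣF (H x) ΣH c ⟩
  (F x + c * H x) + (ΣF + c * ΣH)      ≡⟨ cong₂ _+_ eq (sum-map-affine c k eqs) ⟩
  (k * H x + R x) + (k * ΣH + ΣR)      ≡⟨ collect (H x) (R x) ΣH ΣR k ⟩
  k * (H x + ΣH) + (R x + ΣR)          ∎
  where
  open ≡-Reasoning
  ΣF = sum (map F xs)
  ΣH = sum (map H xs)
  ΣR = sum (map R xs)
  regroup : ∀ f Σf h Σh c → f + Σf + c * (h + Σh) ≡ (f + c * h) + (Σf + c * Σh)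
  regroup = solve-∀
  collect : ∀ h r Σh Σr k → (k * h + r) + (k * Σh + Σr) ≡ k * (h + Σh) + (r + Σr)
  collect = solve-∀

filter-map : ∀ {A B : Set} {P : B → Set} {Q : A → Set} (P? : Decidable P) (Q? : Decidable Q) {k : A → B} →
  (∀ x → does (P? (k x)) ≡ does (Q? x)) → ∀ xs → filter P? (map k xs) ≡ map k (filter Q? xs)
filter-map P? Q? {k} same []       = refl
filter-map P? Q? {k} same (x ∷ xs) with does (P? (k x)) | does (Q? x) | same x
... | true  | true  | _ = cong (k x ∷_) (filter-map P? Q? same xs)
... | false | false | _ = filter-map P? Q? same xs

tabulate-suc : ∀ {A : Set} n (f : Fin (suc n) → A) → tabulate f ≡ tabulate (f ∘ inject₁) ++ [ f (fromℕ n) ]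
tabulate-suc zero    f = refl
tabulate-suc (suc n) f = cong (f zero ∷_) (tabulate-suc n (f ∘ suc))

allFin-suc : ∀ n → allFin (suc n) ≡ map inject₁ (allFin n) ++ [ fromℕ n ]
allFin-suc n = trans (tabulate-suc n id) (cong (_++ [ fromℕ n ]) (sym (map-tabulate id inject₁)))

Any-↭-∷ : ∀ {A : Set} {P : A → Set} {ys} → Any P ys → ∃[ y ] ∃[ ys′ ] ys ↭ y ∷ ys′ × P y
Any-↭-∷ (here py)  = _ , _ , ↭-refl , py
Any-↭-∷ (there p) with Any-↭-∷ p
... | y , ys′ , ys↭ , py = y , _ ∷ ys′ , ↭-trans (↭-prep _ ys↭) (↭-swap _ _ ↭-refl) , py

Unique-resp-↭ : ∀ {A : Set} {xs ys : List A} → xs ↭ ys → Unique xs → Unique ys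
Unique-resp-↭ {A} xs↭ys = PermutationSetoid.Unique-resp-↭ (setoid A) (↭⇒↭ₛ xs↭ys)

module _ {A : Set} {_~_ : A → A → Set} (~-isEquivalence : IsEquivalence _~_)
         (h : A → ℕ) (h-cong : ∀ {x y} → x ~ y → h x ≡ h y) where

  private
    module ~ = IsEquivalence ~-isEquivalence
    Distinct : List A → Set
    Distinct = AllPairs (λ x y → ¬ x ~ y)
    _∈~_ : A → List A → Set
    z ∈~ xs = Any (z ~_) xs

  sum-map-classes : ∀ xs {ys} → Distinct xs → Distinct ys → (∀ z → z ∈~ xs → z ∈~ ys) → (∀ z → z ∈~ ys → z ∈~ xs) →
    sum (map h xs) ≡ sum (map h ys)
  sum-map-classes []       {[]}    _ _ _ _ = refl
  sum-map-classes []       {y ∷ _} _ _ _ back with back y (here ~.refl)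
  ... | ()
  sum-map-classes (x ∷ xs) {ys} (x≁xs ∷ xs!) ys! forth back with Any-↭-∷ (forth x (here ~.refl))
  ... | y , ys′ , ys↭ , x~y = begin
    h x + sum (map h xs)    ≡⟨ cong₂ _+_ (h-cong x~y) (sum-map-classes xs xs! ys′! forth′ back′) ⟩
    h y + sum (map h ys′)   ≡⟨ sum-↭ (Permutation.map⁺ h (↭-sym ys↭)) ⟩
    sum (map h ys)          ∎
    where
    open ≡-Reasoning
    y∷ys′! : Distinct (y ∷ ys′)
    y∷ys′! = PermutationSetoid.AllPairs-resp-↭ (setoid A) (λ a≁b b~a → a≁b (~.sym b~a)) (resp₂ _) (↭⇒↭ₛ ys↭) ys!
    ys′! : Distinct ys′
    ys′! = AllPairs.tail y∷ys′!
    forth′ : ∀ z → z ∈~ xs → z ∈~ ys′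
    forth′ z z∈xs with Any-resp-↭ ys↭ (forth z (there z∈xs))
    ... | here z~y    = ⊥-elim (All¬⇒¬Any x≁xs (Any.map (~.trans (~.trans x~y (~.sym z~y))) z∈xs))
    ... | there z∈ys′ = z∈ys′
    back′ : ∀ z → z ∈~ ys′ → z ∈~ xs
    back′ z z∈ys′ with back z (Any-resp-↭ (↭-sym ys↭) (there z∈ys′))
    ... | here z~x   = ⊥-elim (All¬⇒¬Any (AllPairs.head y∷ys′!) (Any.map (~.trans (~.trans (~.sym x~y) (~.sym z~x))) z∈ys′))
    ... | there z∈xs = z∈xs

module _ {A : Set} (_≟_ : DecidableEquality A) where

  insertAfter : A → A → List A → List A
  insertAfter s v []      = []
  insertAfter s v (a ∷ w) = if does (a ≟ s) then a ∷ v ∷ w else a ∷ insertAfter s v w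

  module _ {s v : A} where

    insertAfter-here : ∀ {a} w → a ≡ s → insertAfter s v (a ∷ w) ≡ a ∷ v ∷ w
    insertAfter-here {a} w a≡s rewrite dec-true (a ≟ s) a≡s = refl

    insertAfter-there : ∀ {a} w → a ≢ s → insertAfter s v (a ∷ w) ≡ a ∷ insertAfter s v w
    insertAfter-there {a} w a≢s rewrite dec-false (a ≟ s) a≢s = refl

    insertAfter-absent : ∀ w → All (_≢ s) w → insertAfter s v w ≡ w
    insertAfter-absent []      []            = refl
    insertAfter-absent (a ∷ w) (a≢s ∷ w≢s) = trans (insertAfter-there w a≢s) (cong (a ∷_) (insertAfter-absent w w≢s))

    insertAfter-++ : ∀ b r → Unique (b ++ r) → insertAfter s v (b ++ r) ≡ insertAfter s v b ++ insertAfter s v r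
    insertAfter-++ []      r _ = refl
    insertAfter-++ (a ∷ b) r (a∉br ∷ br!) with a ≟ s
    ... | yes refl = cong (λ r′ → a ∷ v ∷ b ++ r′) (sym (insertAfter-absent r (All.map ≢-sym (++⁻ʳ b a∉br))))
    ... | no  _    = cong (a ∷_) (insertAfter-++ b r br!)

    insertAfter-concat : ∀ ws → Unique (concat ws) → insertAfter s v (concat ws) ≡ concat (map (insertAfter s v) ws)
    insertAfter-concat []       _  = refl
    insertAfter-concat (w ∷ ws) u! =
      trans (insertAfter-++ w (concat ws) u!) (cong (insertAfter s v w ++_) (insertAfter-concat ws (++⁻ʳ-Unique w u!)))
      where
      ++⁻ʳ-Unique : ∀ b {r} → Unique (b ++ r) → Unique r
      ++⁻ʳ-Unique []      u!       = u!
      ++⁻ʳ-Unique (_ ∷ b) (_ ∷ u!) = ++⁻ʳ-Unique b u!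

map-insertAfter : ∀ {A B : Set} (_≟ᴬ_ : DecidableEquality A) (_≟ᴮ_ : DecidableEquality B) {f : A → B} →
  Injective _≡_ _≡_ f → ∀ s v w → map f (insertAfter _≟ᴬ_ s v w) ≡ insertAfter _≟ᴮ_ (f s) (f v) (map f w)
map-insertAfter _≟ᴬ_ _≟ᴮ_ {f} f-inj s v []      = refl
map-insertAfter _≟ᴬ_ _≟ᴮ_ {f} f-inj s v (a ∷ w) with a ≟ᴬ s
... | yes a≡s = sym (insertAfter-here _≟ᴮ_ (map f w) (cong f a≡s))
... | no  a≢s = trans (cong (f a ∷_) (map-insertAfter _≟ᴬ_ _≟ᴮ_ f-inj s v w))
                      (sym (insertAfter-there _≟ᴮ_ (map f w) (a≢s ∘ f-inj)))

insertAfterEach : {A : Set} → A → List A → List (List A)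
insertAfterEach v []      = []
insertAfterEach v (a ∷ w) = map (a ∷_) ((v ∷ w) ∷ insertAfterEach v w)

length-insertAfterEach : ∀ {A : Set} (v : A) w → length (insertAfterEach v w) ≡ length w
length-insertAfterEach v []      = refl
length-insertAfterEach v (a ∷ w) = cong suc (trans (length-map (a ∷_) (insertAfterEach v w)) (length-insertAfterEach v w))

insertAfterEach≡map-insertAfter : ∀ {A : Set} (_≟_ : DecidableEquality A) v w → Unique w →
  insertAfterEach v w ≡ map (λ x → insertAfter _≟_ x v w) w
insertAfterEach≡map-insertAfter _≟_ v []      _            = refl
insertAfterEach≡map-insertAfter _≟_ v (a ∷ w) (a∉w ∷ w!) =
  cong₂ _∷_ (sym (insertAfter-here _≟_ w refl)) (begin
    map (a ∷_) (insertAfterEach v w)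
      ≡⟨ cong (map (a ∷_)) (insertAfterEach≡map-insertAfter _≟_ v w w!) ⟩
    map (a ∷_) (map (λ x → insertAfter _≟_ x v w) w)
      ≡⟨ sym (map-∘ w) ⟩
    map (λ x → a ∷ insertAfter _≟_ x v w) w
      ≡⟨ sym (map-cong-local (All.map (insertAfter-there _≟_ w) a∉w)) ⟩
    map (λ x → insertAfter _≟_ x v (a ∷ w)) w ∎)
  where open ≡-Reasoning

insertAfter-↭ : ∀ {A : Set} (_≟_ : DecidableEquality A) {s v : A} w → s ∈ w → insertAfter _≟_ s v w ↭ w ++ [ v ]
insertAfter-↭ _≟_ {s} {v} (a ∷ w) s∈ with a ≟ s | s∈
... | yes _    | _          = ↭-prep a (∷↭∷ʳ v w)
... | no  a≢s | here s≡a  = ⊥-elim (a≢s (sym s≡a))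
... | no  _    | there s∈w = ↭-prep a (insertAfter-↭ _≟_ w s∈w)

-- Word statistics under insertion of a new largest letter

T⇒≡true : ∀ {b} → T b → b ≡ true
T⇒≡true = Equivalence.to T-≡

<⇒<ᵇ≡true : ∀ {m n} → m < n → (m <ᵇ n) ≡ true
<⇒<ᵇ≡true = T⇒≡true ∘ <⇒<ᵇ

<⇒>ᵇ≡false : ∀ {m n} → m < n → (n <ᵇ m) ≡ false
<⇒>ᵇ≡false {zero}  {suc n} _         = refl
<⇒>ᵇ≡false {suc m} {suc n} (s≤s m<n) = <⇒>ᵇ≡false m<n

>⇒≤ᵇ≡false : ∀ {m n} → n < m → (m ≤ᵇ n) ≡ false
>⇒≤ᵇ≡false {m} {n} n<m with m ≤ᵇ n | ≤ᵇ⇒≤ m n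
... | false | _   = refl
... | true  | m≤n = ⊥-elim (<⇒≱ n<m (m≤n _))

⟦_⟧ : Bool → ℕ
⟦ b ⟧ = if b then 1 else 0

ascentAt : ℕ → List ℕ → ℕ
ascentAt a []      = 0
ascentAt a (b ∷ _) = ⟦ a <ᵇ b ⟧

occ123At : ℕ → List ℕ → ℕ
occ123At a (b ∷ c ∷ _) = ⟦ (a <ᵇ b) ∧ (b <ᵇ c) ⟧
occ123At a _           = 0

ascents : List ℕ → ℕ
ascents []      = 0
ascents (a ∷ w) = ascentAt a w + ascents w

endsInAscent : List ℕ → ℕ
endsInAscent (a ∷ b ∷ [])    = ⟦ a <ᵇ b ⟧
endsInAscent (a ∷ b ∷ c ∷ w) = endsInAscent (b ∷ c ∷ w)
endsInAscent _               = 0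

occ123-∷ : ∀ a w → occ123 (a ∷ w) ≡ occ123At a w + occ123 w
occ123-∷ a []          = refl
occ123-∷ a (b ∷ [])    = refl
occ123-∷ a (b ∷ c ∷ w) = refl

-- One summand per extension: v right after each letter of w, or appended as a new fixed point;
-- w ++ [ v ] thus occurs twice, also as the insertion after the last letter.
insertionSum : (List ℕ → ℕ) → ℕ → List ℕ → ℕ
insertionSum h v w = sum (map h (insertAfterEach v w)) + h (w ++ [ v ])

sum-map-∷ : ∀ (f : List ℕ → ℕ) a (us : List (List ℕ)) → sum (map f (map (a ∷_) us)) ≡ sum (map (λ u → f (a ∷ u)) us)
sum-map-∷ f a us = cong sum (sym (map-∘ us))

module _ {v : ℕ} where

  sum-occ123At-insertAfterEach : ∀ a w → All (_< v) w →
    sum (map (occ123At a) (insertAfterEach v w)) + occ123At a w ≡ ascentAt a w + length w * occ123At a w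
  sum-occ123At-insertAfterEach a []          _         = refl
  sum-occ123At-insertAfterEach a (b ∷ [])    (b<v ∷ _) rewrite <⇒<ᵇ≡true b<v | ∧-identityʳ (a <ᵇ b) =
    +-identityʳ (⟦ a <ᵇ b ⟧ + 0)
  sum-occ123At-insertAfterEach a (b ∷ c ∷ w) (b<v ∷ _) = begin
    ⟦ (a <ᵇ b) ∧ (b <ᵇ v) ⟧ + sum (map (occ123At a) (map (b ∷_) (map (c ∷_) us))) + t
      ≡⟨ cong₂ (λ x y → x + y + t) (cong (λ z → ⟦ (a <ᵇ b) ∧ z ⟧) (<⇒<ᵇ≡true b<v)) rest ⟩
    ⟦ (a <ᵇ b) ∧ true ⟧ + length us * t + t
      ≡⟨ cong (λ z → ⟦ z ⟧ + length us * t + t) (∧-identityʳ (a <ᵇ b)) ⟩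
    ⟦ a <ᵇ b ⟧ + suc (length (insertAfterEach v w)) * t + t
      ≡⟨ cong (λ l → ⟦ a <ᵇ b ⟧ + suc l * t + t) (length-insertAfterEach v w) ⟩
    ⟦ a <ᵇ b ⟧ + suc (length w) * t + t
      ≡⟨ +-*-suc-shift ⟦ a <ᵇ b ⟧ (length w) t ⟩
    ⟦ a <ᵇ b ⟧ + suc (suc (length w)) * t ∎
    where
    open ≡-Reasoning
    us = (v ∷ w) ∷ insertAfterEach v w
    t  = occ123At a (b ∷ c ∷ w)
    rest : sum (map (occ123At a) (map (b ∷_) (map (c ∷_) us))) ≡ length us * t
    rest = trans (sum-map-∷ (occ123At a) b (map (c ∷_) us))
                 (trans (sum-map-∷ (λ u → occ123At a (b ∷ u)) c us) (sum-map-const t us))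
    +-*-suc-shift : ∀ x l t → x + suc l * t + t ≡ x + suc (suc l) * t
    +-*-suc-shift = solve-∀

  occ123-∷-max : ∀ a w → All (_< v) w → occ123 (a ∷ v ∷ w) ≡ occ123 w
  occ123-∷-max a []          _         = refl
  occ123-∷-max a (b ∷ [])    (b<v ∷ _) rewrite <⇒>ᵇ≡false b<v | ∧-zeroʳ (a <ᵇ v) = refl
  occ123-∷-max a (b ∷ c ∷ w) (b<v ∷ _) rewrite <⇒>ᵇ≡false b<v | ∧-zeroʳ (a <ᵇ v) = refl

  -- Putting v right after the i-th letter destroys the occurrences starting at i - 1 and i and creates
  -- one exactly when w(i-1) < w(i): each occurrence is lost twice, each ascent gained once.
  sum-occ123-insertAfterEach : ∀ w → All (_< v) w →
    sum (map occ123 (insertAfterEach v w)) + 2 * occ123 w ≡ length w * occ123 w + ascents w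
  sum-occ123-insertAfterEach []      _            = refl
  sum-occ123-insertAfterEach (a ∷ w) (_ ∷ w<v) = begin
    occ123 (a ∷ v ∷ w) + sum (map occ123 (map (a ∷_) us)) + 2 * occ123 (a ∷ w)
      ≡⟨ cong₂ (λ x y → x + y + 2 * occ123 (a ∷ w)) (occ123-∷-max a w w<v) split ⟩
    o + (ΣT + ΣO) + 2 * occ123 (a ∷ w)
      ≡⟨ cong (λ z → o + (ΣT + ΣO) + 2 * z) (occ123-∷ a w) ⟩
    o + (ΣT + ΣO) + 2 * (t + o)
      ≡⟨ regroup o ΣT ΣO t ⟩
    o + t + (ΣT + t) + (ΣO + 2 * o)
      ≡⟨ cong₂ (λ x y → o + t + x + y) (sum-occ123At-insertAfterEach a w w<v) (sum-occ123-insertAfterEach w w<v) ⟩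
    o + t + (ascentAt a w + length w * t) + (length w * o + ascents w)
      ≡⟨ collect o t (ascentAt a w) (length w) (ascents w) ⟩
    suc (length w) * (t + o) + (ascentAt a w + ascents w)
      ≡⟨ cong (λ z → suc (length w) * z + ascents (a ∷ w)) (sym (occ123-∷ a w)) ⟩
    suc (length w) * occ123 (a ∷ w) + ascents (a ∷ w) ∎
    where
    open ≡-Reasoning
    us = insertAfterEach v w
    o  = occ123 w
    t  = occ123At a w
    ΣT = sum (map (occ123At a) us)
    ΣO = sum (map occ123 us)
    split : sum (map occ123 (map (a ∷_) us)) ≡ ΣT + ΣO
    split = trans (sum-map-∷ occ123 a us) (trans (cong sum (map-cong (occ123-∷ a) us)) (sum-map-+ (occ123At a) occ123 us))
    regroup : ∀ o ΣT ΣO t → o + (ΣT + ΣO) + 2 * (t + o) ≡ o + t + (ΣT + t) + (ΣO + 2 * o)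
    regroup = solve-∀
    collect : ∀ o t h l A → o + t + (h + l * t) + (l * o + A) ≡ suc l * (t + o) + (h + A)
    collect = solve-∀

  occ123-append-max : ∀ w → All (_< v) w → occ123 (w ++ [ v ]) ≡ occ123 w + endsInAscent w
  occ123-append-max []              _              = refl
  occ123-append-max (a ∷ [])        _              = refl
  occ123-append-max (a ∷ b ∷ [])    (_ ∷ b<v ∷ _) rewrite <⇒<ᵇ≡true b<v | ∧-identityʳ (a <ᵇ b) =
    +-identityʳ ⟦ a <ᵇ b ⟧
  occ123-append-max (a ∷ b ∷ c ∷ w) (_ ∷ bcw<v)    =
    trans (cong (occ123At a (b ∷ c ∷ w) +_) (occ123-append-max (b ∷ c ∷ w) bcw<v))
          (sym (+-assoc (occ123At a (b ∷ c ∷ w)) (occ123 (b ∷ c ∷ w)) _))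

  insertionSum-occ123 : ∀ w → All (_< v) w →
    insertionSum occ123 v w + occ123 w ≡ length w * occ123 w + ascents w + endsInAscent w
  insertionSum-occ123 w w<v = begin
    Σ + occ123 (w ++ [ v ]) + o   ≡⟨ cong (λ z → Σ + z + o) (occ123-append-max w w<v) ⟩
    Σ + (o + e) + o               ≡⟨ regroup Σ o e ⟩
    Σ + 2 * o + e                 ≡⟨ cong (_+ e) (sum-occ123-insertAfterEach w w<v) ⟩
    length w * o + ascents w + e  ∎
    where
    open ≡-Reasoning
    Σ = sum (map occ123 (insertAfterEach v w))
    o = occ123 w
    e = endsInAscent w
    regroup : ∀ Σ o e → Σ + (o + e) + o ≡ Σ + 2 * o + e
    regroup = solve-∀

  sum-ascentAt-insertAfterEach : ∀ a w → sum (map (ascentAt a) (insertAfterEach v w)) ≡ length w * ascentAt a w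
  sum-ascentAt-insertAfterEach a []      = refl
  sum-ascentAt-insertAfterEach a (b ∷ w) =
    trans (sum-map-∷ (ascentAt a) b us)
          (trans (sum-map-const ⟦ a <ᵇ b ⟧ us)
                 (cong (λ l → suc l * ⟦ a <ᵇ b ⟧) (length-insertAfterEach v w)))
    where us = (v ∷ w) ∷ insertAfterEach v w

  ascents-∷-max : ∀ a w → a < v → All (_< v) w → ascents (a ∷ v ∷ w) ≡ 1 + ascents w
  ascents-∷-max a []      a<v _         rewrite <⇒<ᵇ≡true a<v = refl
  ascents-∷-max a (b ∷ w) a<v (b<v ∷ _) rewrite <⇒<ᵇ≡true a<v | <⇒>ᵇ≡false b<v = refl

  sum-ascents-insertAfterEach : ∀ w → All (_< v) w →
    sum (map ascents (insertAfterEach v w)) + ascents w ≡ length w * ascents w + length w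
  sum-ascents-insertAfterEach []      _            = refl
  sum-ascents-insertAfterEach (a ∷ w) (a<v ∷ w<v) = begin
    ascents (a ∷ v ∷ w) + sum (map ascents (map (a ∷_) us)) + (h + A)
      ≡⟨ cong₂ (λ x y → x + y + (h + A)) (ascents-∷-max a w a<v w<v) split ⟩
    1 + A + (length w * h + ΣA) + (h + A)
      ≡⟨ regroup A ΣA h (length w) ⟩
    1 + A + length w * h + h + (ΣA + A)
      ≡⟨ cong (1 + A + length w * h + h +_) (sum-ascents-insertAfterEach w w<v) ⟩
    1 + A + length w * h + h + (length w * A + length w)
      ≡⟨ collect A h (length w) ⟩
    suc (length w) * (h + A) + suc (length w) ∎
    where
    open ≡-Reasoning
    us = insertAfterEach v w
    h  = ascentAt a w
    A  = ascents w
    ΣA = sum (map ascents us)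
    split : sum (map ascents (map (a ∷_) us)) ≡ length w * h + ΣA
    split = trans (sum-map-∷ ascents a us)
                  (trans (sum-map-+ (ascentAt a) ascents us)
                         (cong (_+ ΣA) (sum-ascentAt-insertAfterEach a w)))
    regroup : ∀ A ΣA h l → 1 + A + (l * h + ΣA) + (h + A) ≡ 1 + A + l * h + h + (ΣA + A)
    regroup = solve-∀
    collect : ∀ A h l → 1 + A + l * h + h + (l * A + l) ≡ suc l * (h + A) + suc l
    collect = solve-∀

  ascents-append-max : ∀ a w → All (_< v) (a ∷ w) → ascents ((a ∷ w) ++ [ v ]) ≡ ascents (a ∷ w) + 1
  ascents-append-max a []      (a<v ∷ _) rewrite <⇒<ᵇ≡true a<v = refl
  ascents-append-max a (b ∷ w) (_ ∷ bw<v) =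
    trans (cong (ascentAt a (b ∷ w) +_) (ascents-append-max b w bw<v))
          (sym (+-assoc (ascentAt a (b ∷ w)) (ascents (b ∷ w)) 1))

  insertionSum-ascents : ∀ a w → All (_< v) (a ∷ w) →
    insertionSum ascents v (a ∷ w) ≡ length (a ∷ w) * ascents (a ∷ w) + length (a ∷ w) + 1
  insertionSum-ascents a w aw<v =
    trans (cong (Σ +_) (ascents-append-max a w aw<v))
          (trans (sym (+-assoc Σ (ascents (a ∷ w)) 1))
                 (cong (_+ 1) (sum-ascents-insertAfterEach (a ∷ w) aw<v)))
    where Σ = sum (map ascents (insertAfterEach v (a ∷ w)))

  sum-endsInAscent-insertAfterEach : ∀ a w → All (_< v) (a ∷ w) →
    sum (map endsInAscent (insertAfterEach v (a ∷ w))) + 2 * endsInAscent (a ∷ w) ≡ length (a ∷ w) * endsInAscent (a ∷ w) + 1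
  sum-endsInAscent-insertAfterEach a []          (a<v ∷ _)       rewrite <⇒<ᵇ≡true a<v = refl
  sum-endsInAscent-insertAfterEach a (b ∷ [])    (_ ∷ b<v ∷ _)   rewrite <⇒<ᵇ≡true b<v | <⇒>ᵇ≡false b<v =
    shift ⟦ a <ᵇ b ⟧
    where
    shift : ∀ x → 1 + 0 + 2 * x ≡ x + (x + 0) + 1
    shift = solve-∀
  sum-endsInAscent-insertAfterEach a (b ∷ c ∷ w) (_ ∷ bcw<v) = begin
    l + sum (map endsInAscent (map (a ∷_) (map (b ∷_) us))) + 2 * l
      ≡⟨ cong (λ z → l + z + 2 * l) drop-a ⟩
    l + sum (map endsInAscent (insertAfterEach v (b ∷ c ∷ w))) + 2 * l
      ≡⟨ +-assoc l _ (2 * l) ⟩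
    l + (sum (map endsInAscent (insertAfterEach v (b ∷ c ∷ w))) + 2 * l)
      ≡⟨ cong (l +_) (sum-endsInAscent-insertAfterEach b (c ∷ w) bcw<v) ⟩
    l + (length (b ∷ c ∷ w) * l + 1)
      ≡⟨ sym (+-assoc l _ 1) ⟩
    suc (length (b ∷ c ∷ w)) * l + 1 ∎
    where
    open ≡-Reasoning
    ys = (v ∷ w) ∷ insertAfterEach v w
    us = (v ∷ c ∷ w) ∷ map (c ∷_) ys
    l  = endsInAscent (b ∷ c ∷ w)
    drop-a : sum (map endsInAscent (map (a ∷_) (map (b ∷_) us))) ≡ sum (map endsInAscent (map (b ∷_) us))
    drop-a = cong (endsInAscent (b ∷ v ∷ c ∷ w) +_) (begin
      sum (map endsInAscent (map (a ∷_) (map (b ∷_) (map (c ∷_) ys))))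
        ≡⟨ sum-map-∷ endsInAscent a (map (b ∷_) (map (c ∷_) ys)) ⟩
      sum (map (λ u → endsInAscent (a ∷ u)) (map (b ∷_) (map (c ∷_) ys)))
        ≡⟨ sum-map-∷ (λ u → endsInAscent (a ∷ u)) b (map (c ∷_) ys) ⟩
      sum (map (λ u → endsInAscent (a ∷ b ∷ u)) (map (c ∷_) ys))
        ≡⟨ sum-map-∷ (λ u → endsInAscent (a ∷ b ∷ u)) c ys ⟩
      sum (map (λ u → endsInAscent (b ∷ c ∷ u)) ys)
        ≡⟨ sym (sum-map-∷ (λ u → endsInAscent (b ∷ u)) c ys) ⟩
      sum (map (λ u → endsInAscent (b ∷ u)) (map (c ∷_) ys))
        ≡⟨ sym (sum-map-∷ endsInAscent b (map (c ∷_) ys)) ⟩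
      sum (map endsInAscent (map (b ∷_) (map (c ∷_) ys))) ∎)

  endsInAscent-append-max : ∀ a w → All (_< v) (a ∷ w) → endsInAscent ((a ∷ w) ++ [ v ]) ≡ 1
  endsInAscent-append-max a []          (a<v ∷ _)     rewrite <⇒<ᵇ≡true a<v = refl
  endsInAscent-append-max a (b ∷ [])    (_ ∷ b<v ∷ _) rewrite <⇒<ᵇ≡true b<v = refl
  endsInAscent-append-max a (b ∷ c ∷ w) (_ ∷ bcw<v)   = endsInAscent-append-max b (c ∷ w) bcw<v

  insertionSum-endsInAscent : ∀ a w → All (_< v) (a ∷ w) →
    insertionSum endsInAscent v (a ∷ w) + 2 * endsInAscent (a ∷ w) ≡ length (a ∷ w) * endsInAscent (a ∷ w) + 2
  insertionSum-endsInAscent a w aw<v = begin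
    Σ + endsInAscent ((a ∷ w) ++ [ v ]) + 2 * e   ≡⟨ cong (λ z → Σ + z + 2 * e) (endsInAscent-append-max a w aw<v) ⟩
    Σ + 1 + 2 * e                                  ≡⟨ regroup Σ e ⟩
    Σ + 2 * e + 1                                  ≡⟨ cong (_+ 1) (sum-endsInAscent-insertAfterEach a w aw<v) ⟩
    length (a ∷ w) * e + 1 + 1                     ≡⟨ +-assoc _ 1 1 ⟩
    length (a ∷ w) * e + 2                         ∎
    where
    open ≡-Reasoning
    Σ = sum (map endsInAscent (insertAfterEach v (a ∷ w)))
    e = endsInAscent (a ∷ w)
    regroup : ∀ Σ e → Σ + 1 + 2 * e ≡ Σ + 2 * e + 1
    regroup = solve-∀

-- Orbits

module _ {N : ℕ} (f : Fin N → Fin N) where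

  data FirstVisit (m : Fin N) : Fin N → ℕ → Set where
    arrive : FirstVisit m m 0
    pass   : ∀ {c d} → c ≢ m → FirstVisit m (f c) d → FirstVisit m c (suc d)

  orbitFrom-arrive : ∀ m k → orbitFrom f m (suc k) m ≡ []
  orbitFrom-arrive m k rewrite dec-true (m ≟ᶠ m) refl = refl

  orbitFrom-pass : ∀ {m c} k → c ≢ m → orbitFrom f m (suc k) c ≡ c ∷ orbitFrom f m k (f c)
  orbitFrom-pass {m} {c} k c≢m rewrite dec-false (c ≟ᶠ m) c≢m = refl

  orbitFrom-firstVisit : ∀ {m c d k} → FirstVisit m c d → d ≤ k → orbitFrom f m k c ≡ List.iterate f c d
  orbitFrom-firstVisit {k = zero}  arrive         _         = refl
  orbitFrom-firstVisit {k = suc k} arrive         _         = orbitFrom-arrive _ k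
  orbitFrom-firstVisit {k = suc k} (pass c≢m fv) (s≤s d≤k) =
    trans (orbitFrom-pass k c≢m) (cong (_ ∷_) (orbitFrom-firstVisit fv d≤k))

  firstVisit-avoids : ∀ {m c d} → FirstVisit m c d → All (_≢ m) (List.iterate f c d)
  firstVisit-avoids arrive         = []
  firstVisit-avoids (pass c≢m fv) = c≢m ∷ firstVisit-avoids fv

  firstVisit-unique : ∀ {m c d e} → FirstVisit m c d → FirstVisit m c e → d ≡ e
  firstVisit-unique arrive        arrive        = refl
  firstVisit-unique arrive        (pass m≢m _)  = ⊥-elim (m≢m refl)
  firstVisit-unique (pass m≢m _)  arrive        = ⊥-elim (m≢m refl)
  firstVisit-unique (pass _ fv)   (pass _ fv′)  = cong suc (firstVisit-unique fv fv′)

  firstVisit-∈ : ∀ {m c d y} → FirstVisit m c d → y ∈ List.iterate f c d → ∃[ e ] e ≤ d × FirstVisit m y e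
  firstVisit-∈ fv@(pass _ _) (here refl) = _ , ≤-refl , fv
  firstVisit-∈ (pass _ fv)   (there y∈)  with firstVisit-∈ fv y∈
  ... | e , e≤d , fvʸ = e , m≤n⇒m≤1+n e≤d , fvʸ

  -- c cannot recur before m: it would have two different first-visit times to m
  firstVisit-noReturn : ∀ {m c d} → c ≢ m → FirstVisit m (f c) d → All (c ≢_) (List.iterate f (f c) d)
  firstVisit-noReturn {d = d} c≢m fv = All.tabulate noReturn
    where
    noReturn : ∀ {y} → y ∈ List.iterate f (f _) d → _ ≢ y
    noReturn y∈ refl with firstVisit-∈ fv y∈
    ... | e , e≤d , fvᶜ = 1+n≰n (≤-trans (≤-reflexive (firstVisit-unique (pass c≢m fv) fvᶜ)) e≤d)

  firstVisit-from : ∀ {m} K c → iterate f c K ≡ m → ∃[ d ] d ≤ K × FirstVisit m c d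
  firstVisit-from zero    c refl = 0 , z≤n , arrive
  firstVisit-from {m} (suc K) c hit with c ≟ᶠ m
  ... | yes refl = 0 , z≤n , arrive
  ... | no  c≢m  with firstVisit-from K (f c) hit
  ...   | d , d≤K , fv = suc d , s≤s d≤K , pass c≢m fv

iterate-+ : ∀ {A : Set} (f : A → A) x a b → iterate f x (a + b) ≡ iterate f (iterate f x a) b
iterate-+ f x zero    b = refl
iterate-+ f x (suc a) b = iterate-+ f (f x) a b

⟨$⟩ʳ-injective : ∀ {n} (g : Permutation′ n) → Injective _≡_ _≡_ (g ⟨$⟩ʳ_)
⟨$⟩ʳ-injective g {x} {y} eq = trans (sym (inverseˡ g)) (trans (cong (g ⟨$⟩ˡ_) eq) (inverseˡ g))

iterate-injective : ∀ {A : Set} {f : A → A} → Injective _≡_ _≡_ f → ∀ a {x y} → iterate f x a ≡ iterate f y a → x ≡ y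
iterate-injective f-inj zero    eq = eq
iterate-injective f-inj (suc a) eq = f-inj (iterate-injective f-inj a eq)

iterate-period : ∀ {A : Set} {f : A → A} → Injective _≡_ _≡_ f →
  ∀ x a r → iterate f x a ≡ iterate f x (suc a + r) → iterate f x (suc r) ≡ x
iterate-period {f = f} f-inj x a r same = iterate-injective f-inj a (begin
  iterate f (iterate f x (suc r)) a  ≡⟨ sym (iterate-+ f x (suc r) a) ⟩
  iterate f x (suc r + a)            ≡⟨ cong (λ k → iterate f x (suc k)) (+-comm r a) ⟩
  iterate f x (suc a + r)            ≡⟨ sym same ⟩
  iterate f x a                      ∎)
  where open ≡-Reasoning

suc[n∸suc[m]]≤n : ∀ {m n} → m < n → suc (n ∸ suc m) ≤ n
suc[n∸suc[m]]≤n {m} {suc n} _ = s≤s (m∸n≤m n m)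

-- By pigeonhole two of the iterates m, g m, …, gⁿ m coincide, so some g^(1+r) with r < n fixes m.
returnTime : ∀ {n} (g : Permutation′ n) m → ∃[ d ] suc d ≤ n × FirstVisit (g ⟨$⟩ʳ_) m (g ⟨$⟩ʳ m) d
returnTime {n} g m with pigeonhole (n<1+n n) (λ i → iterate (g ⟨$⟩ʳ_) m (toℕ i))
... | i , j , i<j , same
  with firstVisit-from (g ⟨$⟩ʳ_) (toℕ j ∸ suc (toℕ i)) (g ⟨$⟩ʳ m)
         (iterate-period (⟨$⟩ʳ-injective g) m (toℕ i) _ (trans same (cong (iterate _ m) (sym (m+[n∸m]≡n i<j)))))
... | d , d≤r , fv = d , ≤-trans (s≤s d≤r) (≤-trans (suc[n∸suc[m]]≤n i<j) (≤-pred (toℕ<n j))) , fv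

module _ {N M : ℕ} (h : Fin N → Fin N) (F : Fin M → Fin M) {ι : Fin N → Fin M} (ι-injective : Injective _≡_ _≡_ ι) where

  orbitFrom-map : ∀ {m c d k} → FirstVisit h m c d → All (λ y → F (ι y) ≡ ι (h y)) (List.iterate h c d) → d ≤ k →
    orbitFrom F (ι m) k (ι c) ≡ map ι (List.iterate h c d)
  orbitFrom-map {k = zero}  arrive        _            _         = refl
  orbitFrom-map {k = suc k} arrive        _            _         = orbitFrom-arrive F _ k
  orbitFrom-map {k = suc k} (pass c≢m fv) (Fc≡ ∷ Fcs≡) (s≤s d≤k) =
    trans (orbitFrom-pass F k (c≢m ∘ ι-injective))
          (cong (_ ∷_) (trans (cong (orbitFrom F _ k) Fc≡) (orbitFrom-map fv Fcs≡ d≤k)))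

orbitFrom-cong : ∀ {N} {f f′ : Fin N → Fin N} → (∀ i → f i ≡ f′ i) → ∀ m k c → orbitFrom f m k c ≡ orbitFrom f′ m k c
orbitFrom-cong f≗f′ m zero    c = refl
orbitFrom-cong f≗f′ m (suc k) c with does (c ≟ᶠ m)
... | true  = refl
... | false = cong (c ∷_) (trans (orbitFrom-cong f≗f′ m k _) (cong (orbitFrom _ m k) (f≗f′ c)))

-- Extending a permutation by a new largest point

punchIn-fromℕ : ∀ n (i : Fin n) → punchIn (fromℕ n) i ≡ inject₁ i
punchIn-fromℕ (suc n) zero    = refl
punchIn-fromℕ (suc n) (suc i) = cong suc (punchIn-fromℕ n i)

module _ {n : ℕ} (i j : Fin n) where

  transpose-here : PC.transpose i j i ≡ j
  transpose-here with i ≟ᶠ i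
  ... | yes _   = refl
  ... | no  i≢i = ⊥-elim (i≢i refl)

  transpose-there : PC.transpose i j j ≡ i
  transpose-there with j ≟ᶠ i
  ... | yes j≡i = j≡i
  ... | no  _   with j ≟ᶠ j
  ...   | yes _   = refl
  ...   | no  j≢j = ⊥-elim (j≢j refl)

  transpose-other : ∀ k → k ≢ i → k ≢ j → PC.transpose i j k ≡ k
  transpose-other k k≢i k≢j rewrite dec-false (k ≟ᶠ i) k≢i | dec-false (k ≟ᶠ j) k≢j = refl

module _ {n : ℕ} where

  fixLast : Permutation′ n → Permutation′ (suc n)
  fixLast g = insert (fromℕ n) (fromℕ n) g

  fixLast-fromℕ : ∀ g → fixLast g ⟨$⟩ʳ fromℕ n ≡ fromℕ n
  fixLast-fromℕ g with fromℕ n ≟ᶠ fromℕ n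
  ... | yes _ = refl
  ... | no  ≢ = ⊥-elim (≢ refl)

  fixLast-inject₁ : ∀ g i → fixLast g ⟨$⟩ʳ inject₁ i ≡ inject₁ (g ⟨$⟩ʳ i)
  fixLast-inject₁ g i = begin
    fixLast g ⟨$⟩ʳ inject₁ i              ≡⟨ cong (fixLast g ⟨$⟩ʳ_) (sym (punchIn-fromℕ n i)) ⟩
    fixLast g ⟨$⟩ʳ punchIn (fromℕ n) i    ≡⟨ insert-punchIn (fromℕ n) (fromℕ n) g i ⟩
    punchIn (fromℕ n) (g ⟨$⟩ʳ i)          ≡⟨ punchIn-fromℕ n (g ⟨$⟩ʳ i) ⟩
    inject₁ (g ⟨$⟩ʳ i)                    ∎
    where open ≡-Reasoning

  -- extendAfter g s inserts the new largest point n right after s in its g-cycle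
  -- (as a new fixed point when s = n): it maps s ↦ n ↦ g s.
  extendAfter : Permutation′ n → Fin (suc n) → Permutation′ (suc n)
  extendAfter g s = transpose s (fromℕ n) ∘ₚ fixLast g

  module _ (g : Permutation′ n) (s : Fin (suc n)) where

    extendAfter-s : extendAfter g s ⟨$⟩ʳ s ≡ fromℕ n
    extendAfter-s = trans (cong (fixLast g ⟨$⟩ʳ_) (transpose-here s (fromℕ n))) (fixLast-fromℕ g)

    extendAfter-fromℕ : extendAfter g s ⟨$⟩ʳ fromℕ n ≡ fixLast g ⟨$⟩ʳ s
    extendAfter-fromℕ = cong (fixLast g ⟨$⟩ʳ_) (transpose-there s (fromℕ n))

    extendAfter-inject₁ : ∀ c → inject₁ c ≢ s → extendAfter g s ⟨$⟩ʳ inject₁ c ≡ inject₁ (g ⟨$⟩ʳ c)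
    extendAfter-inject₁ c c≢s =
      trans (cong (fixLast g ⟨$⟩ʳ_) (transpose-other s (fromℕ n) (inject₁ c) c≢s (fromℕ≢inject₁ ∘ sym))) (fixLast-inject₁ g c)

    extendAfter-transpose : ∀ y → extendAfter g s ⟨$⟩ʳ PC.transpose (fromℕ n) s y ≡ fixLast g ⟨$⟩ʳ y
    extendAfter-transpose y = cong (fixLast g ⟨$⟩ʳ_) (PC.transpose-inverse s (fromℕ n))

  restrict : Permutation′ (suc n) → Permutation′ n
  restrict π = remove (fromℕ n) (transpose (fromℕ n) (π ⟨$⟩ˡ fromℕ n) ∘ₚ π)

  extendAfter-restrict : ∀ π → π ≈ₚ extendAfter (restrict π) (π ⟨$⟩ˡ fromℕ n)
  extendAfter-restrict π y = sym (begin
    extendAfter (restrict π) s ⟨$⟩ʳ y                                  ≡⟨⟩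
    fixLast (remove (fromℕ n) ρ) ⟨$⟩ʳ PC.transpose s (fromℕ n) y
      ≡⟨ cong (λ j → insert (fromℕ n) j (remove (fromℕ n) ρ) ⟨$⟩ʳ PC.transpose s (fromℕ n) y) (sym ρ-fromℕ) ⟩
    insert (fromℕ n) (ρ ⟨$⟩ʳ fromℕ n) (remove (fromℕ n) ρ) ⟨$⟩ʳ PC.transpose s (fromℕ n) y
                                                                       ≡⟨ insert-remove (fromℕ n) ρ _ ⟩
    π ⟨$⟩ʳ PC.transpose (fromℕ n) s (PC.transpose s (fromℕ n) y)       ≡⟨ cong (π ⟨$⟩ʳ_) (PC.transpose-inverse (fromℕ n) s) ⟩
    π ⟨$⟩ʳ y                                                           ∎)
    where
    open ≡-Reasoning
    s = π ⟨$⟩ˡ fromℕ n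
    ρ = transpose (fromℕ n) s ∘ₚ π
    ρ-fromℕ : ρ ⟨$⟩ʳ fromℕ n ≡ fromℕ n
    ρ-fromℕ = trans (cong (π ⟨$⟩ʳ_) (transpose-here (fromℕ n) s)) (inverseʳ π)

  extendAfter-injective : ∀ {g g′ s s′} → extendAfter g s ≈ₚ extendAfter g′ s′ → s ≡ s′ × g ≈ₚ g′
  extendAfter-injective {g} {g′} {s} {s′} E≈E′ = s≡s′ , g≈g′
    where
    s≡s′ : s ≡ s′
    s≡s′ = ⟨$⟩ʳ-injective (extendAfter g′ s′)
             (trans (sym (E≈E′ s)) (trans (extendAfter-s g s) (sym (extendAfter-s g′ s′))))
    g≈g′ : g ≈ₚ g′
    g≈g′ z = inject₁-injective (begin
      inject₁ (g ⟨$⟩ʳ z)                                          ≡⟨ sym (fixLast-inject₁ g z) ⟩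
      fixLast g ⟨$⟩ʳ inject₁ z                                    ≡⟨ sym (extendAfter-transpose g s (inject₁ z)) ⟩
      extendAfter g s ⟨$⟩ʳ PC.transpose (fromℕ n) s (inject₁ z)   ≡⟨ E≈E′ (PC.transpose (fromℕ n) s (inject₁ z)) ⟩
      extendAfter g′ s′ ⟨$⟩ʳ PC.transpose (fromℕ n) s (inject₁ z)
        ≡⟨ cong (λ t → extendAfter g′ s′ ⟨$⟩ʳ PC.transpose (fromℕ n) t (inject₁ z)) s≡s′ ⟩
      extendAfter g′ s′ ⟨$⟩ʳ PC.transpose (fromℕ n) s′ (inject₁ z) ≡⟨ extendAfter-transpose g′ s′ (inject₁ z) ⟩
      fixLast g′ ⟨$⟩ʳ inject₁ z                                   ≡⟨ fixLast-inject₁ g′ z ⟩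
      inject₁ (g′ ⟨$⟩ʳ z)                                         ∎)
      where open ≡-Reasoning

fixLast-cong : ∀ {n} {g g′ : Permutation′ n} → g ≈ₚ g′ → fixLast g ≈ₚ fixLast g′
fixLast-cong {n} g≈g′ k with fromℕ n ≟ᶠ k
... | yes _ = refl
... | no  _ = cong (punchIn (fromℕ n)) (g≈g′ _)

extendAfter-cong : ∀ {n} {g g′ : Permutation′ n} → g ≈ₚ g′ → ∀ s → extendAfter g s ≈ₚ extendAfter g′ s
extendAfter-cong g≈g′ s y = fixLast-cong g≈g′ _

-- The cycle form of an extension

cycleMins : ∀ {n} → Permutation′ n → List (Fin n)
cycleMins {n} π = filter (λ m → isCycleMin π m ≟ᵇ true) (allFin n)

cycleWord : ∀ {n} → Permutation′ n → List (Fin n)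
cycleWord π = concatMap (cycleOf π) (cycleMins π)

allGeq-map-inject₁ : ∀ {n} (m : Fin n) w → allGeq (inject₁ m) (map inject₁ w) ≡ allGeq m w
allGeq-map-inject₁ m []      = refl
allGeq-map-inject₁ m (x ∷ w) rewrite toℕ-inject₁ m | toℕ-inject₁ x = cong (_ ∧_) (allGeq-map-inject₁ m w)

allGeq-insertAfter : ∀ {n} (a s v : Fin n) w → toℕ a ≤ toℕ v → allGeq a (insertAfter _≟ᶠ_ s v w) ≡ allGeq a w
allGeq-insertAfter a s v []      a≤v = refl
allGeq-insertAfter a s v (x ∷ w) a≤v with does (x ≟ᶠ s)
... | true  rewrite T⇒≡true (≤⇒≤ᵇ a≤v) = refl
... | false = cong (_ ∧_) (allGeq-insertAfter a s v w a≤v)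

map-toℕ-inject₁ : ∀ {n} (w : List (Fin n)) → map toℕ (map inject₁ w) ≡ map toℕ w
map-toℕ-inject₁ w = trans (sym (map-∘ w)) (map-cong toℕ-inject₁ w)

module _ {n : ℕ} (g : Permutation′ n) (s : Fin (suc n)) where

  private
    h : Fin n → Fin n
    h = g ⟨$⟩ʳ_
    E : Permutation′ (suc n)
    E = extendAfter g s
    F : Fin (suc n) → Fin (suc n)
    F = E ⟨$⟩ʳ_
    last : Fin (suc n)
    last = fromℕ n
    last≢inject₁ : ∀ m → last ≢ inject₁ m
    last≢inject₁ m = fromℕ≢inject₁

  orbitFrom-extendAfter-via-s : ∀ {m c d k} → inject₁ c ≡ s → FirstVisit h m (h c) d →
    All (λ y → inject₁ y ≢ s) (List.iterate h (h c) d) → d ≤ k →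
    orbitFrom F (inject₁ m) (suc k) (F (inject₁ c)) ≡ last ∷ map inject₁ (List.iterate h (h c) d)
  orbitFrom-extendAfter-via-s {m} {c} {d} {k} ιc≡s fv avoid d≤k = begin
    orbitFrom F (inject₁ m) (suc k) (F (inject₁ c))   ≡⟨ cong (orbitFrom F (inject₁ m) (suc k)) F-ιc ⟩
    orbitFrom F (inject₁ m) (suc k) last              ≡⟨ orbitFrom-pass F k (last≢inject₁ m) ⟩
    last ∷ orbitFrom F (inject₁ m) k (F last)         ≡⟨ cong (λ x → last ∷ orbitFrom F (inject₁ m) k x) F-last ⟩
    last ∷ orbitFrom F (inject₁ m) k (inject₁ (h c))  ≡⟨ cong (last ∷_) (orbitFrom-map h F inject₁-injective fv commute d≤k) ⟩
    last ∷ map inject₁ (List.iterate h (h c) d)       ∎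
    where
    open ≡-Reasoning
    F-ιc : F (inject₁ c) ≡ last
    F-ιc = trans (cong F ιc≡s) (extendAfter-s g s)
    F-last : F last ≡ inject₁ (h c)
    F-last = trans (extendAfter-fromℕ g s) (trans (cong (fixLast g ⟨$⟩ʳ_) (sym ιc≡s)) (fixLast-inject₁ g c))
    commute : All (λ y → F (inject₁ y) ≡ inject₁ (h y)) (List.iterate h (h c) d)
    commute = All.map (extendAfter-inject₁ g s _) avoid

  orbitFrom-extendAfter : ∀ {m c d k} → FirstVisit h m c d → suc d ≤ k →
    orbitFrom F (inject₁ m) k (inject₁ c) ≡ insertAfter _≟ᶠ_ s last (map inject₁ (List.iterate h c d))
  orbitFrom-extendAfter {k = suc k} arrive _ = orbitFrom-arrive F _ k
  orbitFrom-extendAfter {m} {k = suc k} (pass {c} {d} c≢m fv) (s≤s d<k) with inject₁ c ≟ᶠ s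
  ... | yes ιc≡s = trans (orbitFrom-pass F k (c≢m ∘ inject₁-injective))
                         (cong (inject₁ c ∷_) (via-s d<k))
    where
    avoid : All (λ y → inject₁ y ≢ s) (List.iterate h (h c) d)
    avoid = All.map (λ c≢y ιy≡s → c≢y (inject₁-injective (trans ιc≡s (sym ιy≡s)))) (firstVisit-noReturn h c≢m fv)
    via-s : ∀ {k} → suc d ≤ k → orbitFrom F (inject₁ m) k (F (inject₁ c)) ≡ last ∷ map inject₁ (List.iterate h (h c) d)
    via-s (s≤s d≤k) = orbitFrom-extendAfter-via-s ιc≡s fv avoid d≤k
  ... | no  ιc≢s = trans (orbitFrom-pass F k (c≢m ∘ inject₁-injective))
    (trans (cong (λ x → inject₁ c ∷ orbitFrom F (inject₁ m) k x) (extendAfter-inject₁ g s c ιc≢s))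
           (cong (inject₁ c ∷_) (orbitFrom-extendAfter fv d<k)))

  cycleOf-extendAfter : ∀ m → cycleOf (extendAfter g s) (inject₁ m) ≡ insertAfter _≟ᶠ_ s last (map inject₁ (cycleOf g m))
  cycleOf-extendAfter m with returnTime g m
  ... | d , d<n , fv rewrite orbitFrom-firstVisit h fv (≤-trans (n≤1+n d) d<n) = by-cases (inject₁ m ≟ᶠ s)
    where
    by-cases : Dec (inject₁ m ≡ s) →
      inject₁ m ∷ orbitFrom F (inject₁ m) (suc n) (F (inject₁ m))
        ≡ insertAfter _≟ᶠ_ s last (inject₁ m ∷ map inject₁ (List.iterate h (h m) d))
    by-cases (yes ιm≡s) =
      trans (cong (inject₁ m ∷_) (orbitFrom-extendAfter-via-s ιm≡s fv avoid (≤-trans (n≤1+n d) d<n)))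
            (sym (insertAfter-here _≟ᶠ_ _ ιm≡s))
      where
      avoid : All (λ y → inject₁ y ≢ s) (List.iterate h (h m) d)
      avoid = All.map (λ y≢m ιy≡s → y≢m (inject₁-injective (trans ιy≡s (sym ιm≡s)))) (firstVisit-avoids h fv)
    by-cases (no ιm≢s) =
      trans (cong (λ x → inject₁ m ∷ orbitFrom F (inject₁ m) (suc n) x) (extendAfter-inject₁ g s m ιm≢s))
            (trans (cong (inject₁ m ∷_) (orbitFrom-extendAfter fv (m≤n⇒m≤1+n d<n)))
                   (sym (insertAfter-there _≟ᶠ_ _ ιm≢s)))

  isCycleMin-extendAfter-inject₁ : ∀ m → isCycleMin E (inject₁ m) ≡ isCycleMin g m
  isCycleMin-extendAfter-inject₁ m = begin
    allGeq (inject₁ m) (cycleOf E (inject₁ m))                                     ≡⟨ cong (allGeq (inject₁ m)) (cycleOf-extendAfter m) ⟩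
    allGeq (inject₁ m) (insertAfter _≟ᶠ_ s last (map inject₁ (cycleOf g m)))   ≡⟨ allGeq-insertAfter (inject₁ m) s last _ ιm≤last ⟩
    allGeq (inject₁ m) (map inject₁ (cycleOf g m))                                 ≡⟨ allGeq-map-inject₁ m (cycleOf g m) ⟩
    allGeq m (cycleOf g m)                                                         ∎
    where
    open ≡-Reasoning
    ιm≤last : toℕ (inject₁ m) ≤ toℕ last
    ιm≤last rewrite toℕ-inject₁ m | toℕ-fromℕ n = <⇒≤ (toℕ<n m)

  cycleMins-extendAfter : cycleMins E ≡ map inject₁ (cycleMins g) ++ filter (λ m → isCycleMin E m ≟ᵇ true) [ last ]
  cycleMins-extendAfter =
    trans (cong (filter P?) (allFin-suc n))
          (trans (filter-++ P? (map inject₁ (allFin n)) [ last ])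
                 (cong (_++ filter P? [ last ])
                       (filter-map P? (λ m → isCycleMin g m ≟ᵇ true)
                                   (λ m → cong (λ b → does (b ≟ᵇ true)) (isCycleMin-extendAfter-inject₁ m))
                                   (allFin n))))
    where
    P? = λ m → isCycleMin E m ≟ᵇ true

  cycleWord-extendAfter : Unique (cycleWord g) →
    cycleWord E ≡ insertAfter _≟ᶠ_ s last (map inject₁ (cycleWord g))
                  ++ concatMap (cycleOf E) (filter (λ m → isCycleMin E m ≟ᵇ true) [ last ])
  cycleWord-extendAfter cw! = begin
    concatMap (cycleOf E) (cycleMins E)
      ≡⟨ cong (concatMap (cycleOf E)) cycleMins-extendAfter ⟩
    concatMap (cycleOf E) (map inject₁ mins ++ rest)
      ≡⟨ concatMap-++ (cycleOf E) (map inject₁ mins) rest ⟩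
    concatMap (cycleOf E) (map inject₁ mins) ++ concatMap (cycleOf E) rest
      ≡⟨ cong (_++ concatMap (cycleOf E) rest) lifted ⟩
    insertAfter _≟ᶠ_ s last (map inject₁ (cycleWord g)) ++ concatMap (cycleOf E) rest ∎
    where
    open ≡-Reasoning
    mins = cycleMins g
    rest = filter (λ m → isCycleMin E m ≟ᵇ true) [ last ]
    blocks≡ : concat (map (map inject₁ ∘ cycleOf g) mins) ≡ map inject₁ (cycleWord g)
    blocks≡ = trans (cong concat (map-∘ mins)) (concat-map (map (cycleOf g) mins))
    blocks! : Unique (concat (map (map inject₁ ∘ cycleOf g) mins))
    blocks! = subst Unique (sym blocks≡) (Unique.map⁺ inject₁-injective cw!)
    lifted : concatMap (cycleOf E) (map inject₁ mins) ≡ insertAfter _≟ᶠ_ s last (map inject₁ (cycleWord g))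
    lifted = begin
      concatMap (cycleOf E) (map inject₁ mins)
        ≡⟨ concatMap-map (cycleOf E) inject₁ mins ⟩
      concatMap (cycleOf E ∘ inject₁) mins
        ≡⟨ concatMap-cong cycleOf-extendAfter mins ⟩
      concatMap (insertAfter _≟ᶠ_ s last ∘ map inject₁ ∘ cycleOf g) mins
        ≡⟨ cong concat (map-∘ mins) ⟩
      concat (map (insertAfter _≟ᶠ_ s last) (map (map inject₁ ∘ cycleOf g) mins))
        ≡⟨ sym (insertAfter-concat _≟ᶠ_ (map (map inject₁ ∘ cycleOf g) mins) blocks!) ⟩
      insertAfter _≟ᶠ_ s last (concat (map (map inject₁ ∘ cycleOf g) mins))
        ≡⟨ cong (insertAfter _≟ᶠ_ s last) blocks≡ ⟩
      insertAfter _≟ᶠ_ s last (map inject₁ (cycleWord g)) ∎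

module _ {n : ℕ} (g : Permutation′ n) where

  private
    last : Fin (suc n)
    last = fromℕ n

  cycleOf-extendAfter-fromℕ : cycleOf (extendAfter g last) last ≡ [ last ]
  cycleOf-extendAfter-fromℕ = cong (last ∷_) (begin
    orbitFrom F last (suc n) (F last)  ≡⟨ cong (orbitFrom F last (suc n)) F-last ⟩
    orbitFrom F last (suc n) last      ≡⟨ orbitFrom-arrive F last n ⟩
    []                                 ∎)
    where
    open ≡-Reasoning
    F = extendAfter g last ⟨$⟩ʳ_
    F-last : F last ≡ last
    F-last = trans (extendAfter-fromℕ g last) (fixLast-fromℕ g)

  isCycleMin-extendAfter-fromℕ : isCycleMin (extendAfter g last) last ≡ true
  isCycleMin-extendAfter-fromℕ =
    trans (cong (allGeq last) cycleOf-extendAfter-fromℕ) (cong (_∧ true) (T⇒≡true (≤⇒≤ᵇ (≤-refl {toℕ last}))))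

  isCycleMin-extendAfter-inject₁-fromℕ : ∀ x → isCycleMin (extendAfter g (inject₁ x)) last ≡ false
  isCycleMin-extendAfter-inject₁-fromℕ x = begin
    allGeq last (last ∷ orbitFrom F last (suc n) (F last))
      ≡⟨ cong (λ y → allGeq last (last ∷ orbitFrom F last (suc n) y)) F-last ⟩
    allGeq last (last ∷ orbitFrom F last (suc n) (inject₁ (g ⟨$⟩ʳ x)))
      ≡⟨ cong (λ r → allGeq last (last ∷ r)) (orbitFrom-pass F n (fromℕ≢inject₁ ∘ sym)) ⟩
    (toℕ last ≤ᵇ toℕ last) ∧ ((toℕ last ≤ᵇ toℕ (inject₁ (g ⟨$⟩ʳ x))) ∧ later)
      ≡⟨ cong (λ b → (toℕ last ≤ᵇ toℕ last) ∧ (b ∧ later)) (>⇒≤ᵇ≡false gx<last) ⟩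
    (toℕ last ≤ᵇ toℕ last) ∧ false
      ≡⟨ ∧-zeroʳ _ ⟩
    false ∎
    where
    open ≡-Reasoning
    F = extendAfter g (inject₁ x) ⟨$⟩ʳ_
    later = allGeq last (orbitFrom F last n (F (inject₁ (g ⟨$⟩ʳ x))))
    F-last : F last ≡ inject₁ (g ⟨$⟩ʳ x)
    F-last = trans (extendAfter-fromℕ g (inject₁ x)) (fixLast-inject₁ g x)
    gx<last : toℕ (inject₁ (g ⟨$⟩ʳ x)) < toℕ last
    gx<last rewrite toℕ-inject₁ (g ⟨$⟩ʳ x) | toℕ-fromℕ n = toℕ<n (g ⟨$⟩ʳ x)

module _ {n : ℕ} (g : Permutation′ n) (flatten! : Unique (flatten g)) where

  private
    last : Fin (suc n)
    last = fromℕ n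
    cw = cycleWord g
    cw! : Unique cw
    cw! = Unique.map⁻ flatten!

  flatten-extendAfter-inject₁ : ∀ x → flatten (extendAfter g (inject₁ x)) ≡ insertAfter _≟_ (toℕ x) n (flatten g)
  flatten-extendAfter-inject₁ x = begin
    map toℕ (cycleWord E)
      ≡⟨ cong (map toℕ) (cycleWord-extendAfter g s cw!) ⟩
    map toℕ (insertAfter _≟ᶠ_ s last (map inject₁ cw) ++ concatMap (cycleOf E) (filter P? [ last ]))
      ≡⟨ cong (λ r → map toℕ (insertAfter _≟ᶠ_ s last (map inject₁ cw) ++ concatMap (cycleOf E) r)) no-new-cycle ⟩
    map toℕ (insertAfter _≟ᶠ_ s last (map inject₁ cw) ++ [])
      ≡⟨ cong (map toℕ) (++-identityʳ _) ⟩
    map toℕ (insertAfter _≟ᶠ_ s last (map inject₁ cw))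
      ≡⟨ map-insertAfter _≟ᶠ_ _≟_ toℕ-injective s last (map inject₁ cw) ⟩
    insertAfter _≟_ (toℕ (inject₁ x)) (toℕ last) (map toℕ (map inject₁ cw))
      ≡⟨ cong₂ (λ a v → insertAfter _≟_ a v (map toℕ (map inject₁ cw))) (toℕ-inject₁ x) (toℕ-fromℕ n) ⟩
    insertAfter _≟_ (toℕ x) n (map toℕ (map inject₁ cw))
      ≡⟨ cong (insertAfter _≟_ (toℕ x) n) (map-toℕ-inject₁ cw) ⟩
    insertAfter _≟_ (toℕ x) n (map toℕ cw) ∎
    where
    open ≡-Reasoning
    s = inject₁ x
    E = extendAfter g s
    P? = λ m → isCycleMin E m ≟ᵇ true
    no-new-cycle : filter P? [ last ] ≡ []
    no-new-cycle = filter-reject P? λ isMin → case trans (sym isMin) (isCycleMin-extendAfter-inject₁-fromℕ g x) of λ ()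

  flatten-extendAfter-fromℕ : flatten (extendAfter g last) ≡ flatten g ++ [ n ]
  flatten-extendAfter-fromℕ = begin
    map toℕ (cycleWord E)
      ≡⟨ cong (map toℕ) (cycleWord-extendAfter g last cw!) ⟩
    map toℕ (insertAfter _≟ᶠ_ last last (map inject₁ cw) ++ concatMap (cycleOf E) (filter P? [ last ]))
      ≡⟨ cong₂ (λ w r → map toℕ (w ++ concatMap (cycleOf E) r)) (insertAfter-absent _≟ᶠ_ (map inject₁ cw) last-new) new-cycle ⟩
    map toℕ (map inject₁ cw ++ cycleOf E last ++ [])
      ≡⟨ cong (λ r → map toℕ (map inject₁ cw ++ r ++ [])) (cycleOf-extendAfter-fromℕ g) ⟩
    map toℕ (map inject₁ cw ++ [ last ])
      ≡⟨ map-++ toℕ (map inject₁ cw) [ last ] ⟩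
    map toℕ (map inject₁ cw) ++ [ toℕ last ]
      ≡⟨ cong₂ (λ w v → w ++ [ v ]) (map-toℕ-inject₁ cw) (toℕ-fromℕ n) ⟩
    map toℕ cw ++ [ n ] ∎
    where
    open ≡-Reasoning
    E = extendAfter g last
    P? = λ m → isCycleMin E m ≟ᵇ true
    new-cycle : filter P? [ last ] ≡ [ last ]
    new-cycle = filter-accept P? (isCycleMin-extendAfter-fromℕ g)
    last-new : All (_≢ last) (map inject₁ cw)
    last-new = All.map⁺ (All.universal (λ y → fromℕ≢inject₁ ∘ sym) cw)

module _ {n : ℕ} {π σ : Permutation′ n} (π≈σ : π ≈ₚ σ) where

  cycleOf-cong : ∀ m → cycleOf π m ≡ cycleOf σ m
  cycleOf-cong m = cong (m ∷_) (trans (orbitFrom-cong π≈σ m n (π ⟨$⟩ʳ m)) (cong (orbitFrom (σ ⟨$⟩ʳ_) m n) (π≈σ m)))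

  flatten-cong : flatten π ≡ flatten σ
  flatten-cong = cong (map toℕ) (trans (cong (concatMap (cycleOf π)) mins≡) (concatMap-cong cycleOf-cong (cycleMins σ)))
    where
    isMin≡ : ∀ m → isCycleMin π m ≡ isCycleMin σ m
    isMin≡ m = cong (allGeq m) (cycleOf-cong m)
    mins≡ : cycleMins π ≡ cycleMins σ
    mins≡ = filter-≐ (λ m → isCycleMin π m ≟ᵇ true) (λ m → isCycleMin σ m ≟ᵇ true)
                     ((λ {m} → trans (sym (isMin≡ m))) , (λ {m} → trans (isMin≡ m))) (allFin n)

-- An explicit enumeration of the permutations

data LastView {n : ℕ} : Fin (suc n) → Set where
  is-inject₁ : ∀ x → LastView (inject₁ x)
  is-last    : LastView (fromℕ n)

lastView : ∀ {n} (i : Fin (suc n)) → LastView i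
lastView {zero}  zero    = is-last
lastView {suc n} zero    = is-inject₁ zero
lastView {suc n} (suc i) with lastView i
... | is-inject₁ x = is-inject₁ (suc x)
... | is-last      = is-last

letters : ℕ → List ℕ
letters n = map toℕ (allFin n)

letters-suc : ∀ n → letters (suc n) ≡ letters n ++ [ n ]
letters-suc n = begin
  map toℕ (allFin (suc n))                          ≡⟨ cong (map toℕ) (allFin-suc n) ⟩
  map toℕ (map inject₁ (allFin n) ++ [ fromℕ n ])   ≡⟨ map-++ toℕ (map inject₁ (allFin n)) [ fromℕ n ] ⟩
  map toℕ (map inject₁ (allFin n)) ++ [ toℕ (fromℕ n) ]
                                                    ≡⟨ cong₂ (λ w v → w ++ [ v ]) (map-toℕ-inject₁ (allFin n)) (toℕ-fromℕ n) ⟩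
  letters n ++ [ n ]                                ∎
  where open ≡-Reasoning

letters-unique : ∀ n → Unique (letters n)
letters-unique n = Unique.map⁺ toℕ-injective (Unique.allFin⁺ n)

letters-< : ∀ n → All (_< n) (letters n)
letters-< n = All.map⁺ (All.universal toℕ<n (allFin n))

module _ {n : ℕ} {g : Permutation′ n} (flatten↭ : flatten g ↭ letters n) where

  flatten-unique : Unique (flatten g)
  flatten-unique = Unique-resp-↭ (↭-sym flatten↭) (letters-unique n)

  flatten-extendAfter-↭ : ∀ s → flatten (extendAfter g s) ↭ letters (suc n)
  flatten-extendAfter-↭ s with lastView s
  ... | is-last = begin
    flatten (extendAfter g (fromℕ n))  ≡⟨ flatten-extendAfter-fromℕ g flatten-unique ⟩
    flatten g ++ [ n ]                 ↭⟨ ++⁺ʳ [ n ] flatten↭ ⟩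
    letters n ++ [ n ]                 ≡⟨ letters-suc n ⟨
    letters (suc n)                    ∎
    where open PermutationReasoning
  ... | is-inject₁ x = begin
    flatten (extendAfter g (inject₁ x))         ≡⟨ flatten-extendAfter-inject₁ g flatten-unique x ⟩
    insertAfter _≟_ (toℕ x) n (flatten g)       ↭⟨ insertAfter-↭ _≟_ (flatten g) x∈flatten ⟩
    flatten g ++ [ n ]                          ↭⟨ ++⁺ʳ [ n ] flatten↭ ⟩
    letters n ++ [ n ]                          ≡⟨ letters-suc n ⟨
    letters (suc n)                             ∎
    where
    open PermutationReasoning
    x∈flatten : toℕ x ∈ flatten g
    x∈flatten = ∈-resp-↭ (↭-sym flatten↭) (∈-map⁺ toℕ (∈-allFin x))

extensions : ∀ {n} → Permutation′ n → List (Permutation′ (suc n))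
extensions {n} g = map (extendAfter g) (allFin (suc n))

enumeration : ∀ n → List (Permutation′ n)
enumeration zero    = [ idₚ ]
enumeration (suc n) = concatMap extensions (enumeration n)

flatten-enumeration : ∀ n → All (λ g → flatten g ↭ letters n) (enumeration n)
flatten-enumeration zero    = ↭-refl ∷ []
flatten-enumeration (suc n) =
  All.concat⁺ (All.map⁺ (All.map (λ flatten↭ → All.map⁺ (All.universal (flatten-extendAfter-↭ flatten↭) _)) (flatten-enumeration n)))

enumeration-complete : ∀ n (π : Permutation′ n) → Any (π ≈ₚ_) (enumeration n)
enumeration-complete zero    π = here λ ()
enumeration-complete (suc n) π =
  Any.concat⁺ (Any.map⁺ (Any.map among-extensions (enumeration-complete n (restrict π))))
  where
  among-extensions : ∀ {g} → restrict π ≈ₚ g → Any (π ≈ₚ_) (extensions g)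
  among-extensions r≈g = Any.map⁺ (Any.map (λ { refl y → trans (extendAfter-restrict π y) (extendAfter-cong r≈g _ y) })
                                            (∈-allFin (π ⟨$⟩ˡ fromℕ n)))

enumeration-distinct : ∀ n → AllPairs (λ σ τ → ¬ σ ≈ₚ τ) (enumeration n)
enumeration-distinct zero    = [] ∷ []
enumeration-distinct (suc n) =
  AllPairs.concat⁺ (All.map⁺ (All.universal extensions-distinct (enumeration n)))
                   (AllPairs.map⁺ {R = Apart} {f = extensions}
                                  (AllPairs.map (λ {g} {g′} → extensions-apart {g} {g′}) (enumeration-distinct n)))
  where
  extensions-distinct : ∀ g → AllPairs (λ σ τ → ¬ σ ≈ₚ τ) (extensions g)
  extensions-distinct g = AllPairs.map⁺ (AllPairs.map (λ s≢s′ E≈E′ → s≢s′ (proj₁ (extendAfter-injective E≈E′)))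
                                                       (Unique.allFin⁺ (suc n)))
  Apart : List (Permutation′ (suc n)) → List (Permutation′ (suc n)) → Set
  Apart σs τs = All (λ σ → All (λ τ → ¬ σ ≈ₚ τ) τs) σs
  extensions-apart : ∀ {g g′} → ¬ g ≈ₚ g′ → Apart (extensions g) (extensions g′)
  extensions-apart g≉g′ =
    All.map⁺ (All.universal (λ s → All.map⁺ (All.universal (λ s′ E≈E′ → g≉g′ (proj₂ (extendAfter-injective E≈E′))) _)) _)

enumeration-isEnumeration : ∀ n → IsEnumeration n (enumeration n)
enumeration-isEnumeration n = enumeration-complete n , enumeration-distinct n

length-enumeration : ∀ n → length (enumeration n) ≡ n !
length-enumeration zero    = refl
length-enumeration (suc n) = begin
  length (concatMap extensions (enumeration n))                               ≡⟨ length≡sum-map-1 (concatMap extensions (enumeration n)) ⟩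
  sum (map (λ _ → 1) (concatMap extensions (enumeration n)))                  ≡⟨ sum-map-concatMap (λ _ → 1) extensions (enumeration n) ⟩
  sum (map (λ g → sum (map (λ _ → 1) (extensions g))) (enumeration n))        ≡⟨ cong sum (map-cong length-extensions (enumeration n)) ⟩
  sum (map (λ _ → suc n) (enumeration n))                                     ≡⟨ sum-map-const (suc n) (enumeration n) ⟩
  length (enumeration n) * suc n                                              ≡⟨ cong (_* suc n) (length-enumeration n) ⟩
  n ! * suc n                                                                 ≡⟨ *-comm (n !) (suc n) ⟩
  suc n ! ∎
  where
  open ≡-Reasoning
  length-extensions : ∀ g → sum (map (λ _ → 1) (extensions g)) ≡ suc n
  length-extensions g = trans (sym (length≡sum-map-1 (extensions g)))
                              (trans (length-map (extendAfter g) (allFin (suc n))) (length-tabulate id))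

sum-map-enumeration : ∀ {n} (h : Permutation′ n → ℕ) → (∀ {π σ} → π ≈ₚ σ → h π ≡ h σ) →
  ∀ {L L′} → IsEnumeration n L → IsEnumeration n L′ → sum (map h L) ≡ sum (map h L′)
sum-map-enumeration h h-cong {L} (complete , distinct) (complete′ , distinct′) =
  sum-map-classes ≈ₚ-isEquivalence h h-cong L distinct distinct′ (λ π _ → complete′ π) (λ π _ → complete π)
  where
  ≈ₚ-isEquivalence : IsEquivalence _≈ₚ_
  ≈ₚ-isEquivalence = record
    { refl  = λ _ → refl
    ; sym   = λ π≈σ i → sym (π≈σ i)
    ; trans = λ π≈σ σ≈τ i → trans (π≈σ i) (σ≈τ i)
    }

-- Totals over the enumeration

module _ {n : ℕ} {g : Permutation′ n} (flatten↭ : flatten g ↭ letters n) (h : List ℕ → ℕ) where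

  sum-extensions : sum (map (λ π → h (flatten π)) (extensions g)) ≡ insertionSum h n (flatten g)
  sum-extensions = begin
    sum (map (λ π → h (flatten π)) (map (extendAfter g) (allFin (suc n))))
      ≡⟨ cong sum (sym (map-∘ (allFin (suc n)))) ⟩
    sum (map hE (allFin (suc n)))
      ≡⟨ cong (sum ∘ map hE) (allFin-suc n) ⟩
    sum (map hE (map inject₁ (allFin n) ++ [ fromℕ n ]))
      ≡⟨ cong sum (map-++ hE (map inject₁ (allFin n)) [ fromℕ n ]) ⟩
    sum (map hE (map inject₁ (allFin n)) ++ [ hE (fromℕ n) ])
      ≡⟨ sum-++ (map hE (map inject₁ (allFin n))) [ hE (fromℕ n) ] ⟩
    sum (map hE (map inject₁ (allFin n))) + (hE (fromℕ n) + 0)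
      ≡⟨ cong₂ _+_ insertions (trans (+-identityʳ _) (cong h (flatten-extendAfter-fromℕ g w!))) ⟩
    sum (map h (insertAfterEach n w)) + h (w ++ [ n ]) ∎
    where
    open ≡-Reasoning
    w = flatten g
    w! : Unique w
    w! = flatten-unique {g = g} flatten↭
    hE : Fin (suc n) → ℕ
    hE s = h (flatten (extendAfter g s))
    insertAt : ℕ → ℕ
    insertAt y = h (insertAfter _≟_ y n w)
    insertions : sum (map hE (map inject₁ (allFin n))) ≡ sum (map h (insertAfterEach n w))
    insertions = begin
      sum (map hE (map inject₁ (allFin n)))
        ≡⟨ cong sum (sym (map-∘ (allFin n))) ⟩
      sum (map (hE ∘ inject₁) (allFin n))
        ≡⟨ cong sum (map-cong (cong h ∘ flatten-extendAfter-inject₁ g w!) (allFin n)) ⟩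
      sum (map (insertAt ∘ toℕ) (allFin n))
        ≡⟨ cong sum (map-∘ (allFin n)) ⟩
      sum (map insertAt (letters n))
        ≡⟨ sum-↭ (Permutation.map⁺ insertAt (↭-sym flatten↭)) ⟩
      sum (map insertAt w)
        ≡⟨ cong sum (map-∘ w) ⟩
      sum (map h (map (λ y → insertAfter _≟_ y n w) w))
        ≡⟨ cong (sum ∘ map h) (sym (insertAfterEach≡map-insertAfter _≟_ n w w!)) ⟩
      sum (map h (insertAfterEach n w)) ∎

sum-const-enumeration : ∀ n k → sum (map (λ _ → k) (enumeration n)) ≡ k * n !
sum-const-enumeration n k = trans (sum-map-const k (enumeration n)) (trans (cong (_* k) (length-enumeration n)) (*-comm (n !) k))

total : (List ℕ → ℕ) → ℕ → ℕ
total h n = sum (map (λ π → h (flatten π)) (enumeration n))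

total-suc : ∀ h n → total h (suc n) ≡ sum (map (λ g → insertionSum h n (flatten g)) (enumeration n))
total-suc h n = trans (sum-map-concatMap (λ π → h (flatten π)) extensions (enumeration n))
                      (sum-map-cong-All (All.map (λ flatten↭ → sum-extensions flatten↭ h) (flatten-enumeration n)))

module _ {n : ℕ} {w : List ℕ} (w↭ : w ↭ letters n) where

  length-↭-letters : length w ≡ n
  length-↭-letters = trans (↭-length w↭) (trans (length-map toℕ (allFin n)) (length-tabulate id))

  <-↭-letters : All (_< n) w
  <-↭-letters = All-resp-↭ (↭-sym w↭) (letters-< n)

  insertionSum-occ123-↭ : insertionSum occ123 n w + 1 * occ123 w ≡ n * occ123 w + (ascents w + endsInAscent w)
  insertionSum-occ123-↭ = begin
    insertionSum occ123 n w + 1 * occ123 w            ≡⟨ cong (insertionSum occ123 n w +_) (*-identityˡ _) ⟩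
    insertionSum occ123 n w + occ123 w                ≡⟨ insertionSum-occ123 w <-↭-letters ⟩
    length w * occ123 w + ascents w + endsInAscent w  ≡⟨ cong (λ l → l * occ123 w + ascents w + endsInAscent w) length-↭-letters ⟩
    n * occ123 w + ascents w + endsInAscent w         ≡⟨ +-assoc (n * occ123 w) _ _ ⟩
    n * occ123 w + (ascents w + endsInAscent w)       ∎
    where open ≡-Reasoning

insertionSum-ascents-↭ : ∀ {n} w → w ↭ letters (suc n) → insertionSum ascents (suc n) w + 0 * ascents w ≡ suc n * ascents w + suc (suc n)
insertionSum-ascents-↭ []      w↭ with length-↭-letters w↭
... | ()
insertionSum-ascents-↭ {n} (a ∷ w) w↭ =
  trans (+-identityʳ _)
        (trans (insertionSum-ascents a w (<-↭-letters w↭))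
               (trans (cong (λ l → l * ascents (a ∷ w) + l + 1) (length-↭-letters w↭)) (shift (suc n) (ascents (a ∷ w)))))
  where
  shift : ∀ l x → l * x + l + 1 ≡ l * x + suc l
  shift = solve-∀

insertionSum-endsInAscent-↭ : ∀ {n} w → w ↭ letters (suc n) →
  insertionSum endsInAscent (suc n) w + 2 * endsInAscent w ≡ suc n * endsInAscent w + 2
insertionSum-endsInAscent-↭ []      w↭ with length-↭-letters w↭
... | ()
insertionSum-endsInAscent-↭ (a ∷ w) w↭ =
  trans (insertionSum-endsInAscent a w (<-↭-letters w↭)) (cong (λ l → l * endsInAscent (a ∷ w) + 2) (length-↭-letters w↭))

total-occ123-suc : ∀ n → total occ123 (suc n) + 1 * total occ123 n ≡ n * total occ123 n + (total ascents n + total endsInAscent n)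
total-occ123-suc n = begin
  total occ123 (suc n) + 1 * total occ123 n
    ≡⟨ cong (_+ 1 * total occ123 n) (total-suc occ123 n) ⟩
  sum (map (λ g → insertionSum occ123 n (flatten g)) (enumeration n)) + 1 * total occ123 n
    ≡⟨ sum-map-affine 1 n (All.map insertionSum-occ123-↭ (flatten-enumeration n)) ⟩
  n * total occ123 n + sum (map (λ g → ascents (flatten g) + endsInAscent (flatten g)) (enumeration n))
    ≡⟨ cong (n * total occ123 n +_) (sum-map-+ (ascents ∘ flatten) (endsInAscent ∘ flatten) (enumeration n)) ⟩
  n * total occ123 n + (total ascents n + total endsInAscent n) ∎
  where open ≡-Reasoning

total-ascents-suc : ∀ n → total ascents (suc (suc n)) + 0 * total ascents (suc n) ≡ suc n * total ascents (suc n) + suc (suc n) !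
total-ascents-suc n = begin
  total ascents (suc (suc n)) + 0 * total ascents (suc n)
    ≡⟨ cong (_+ 0 * total ascents (suc n)) (total-suc ascents (suc n)) ⟩
  sum (map (λ g → insertionSum ascents (suc n) (flatten g)) (enumeration (suc n))) + 0 * total ascents (suc n)
    ≡⟨ sum-map-affine 0 (suc n) (All.map (insertionSum-ascents-↭ _) (flatten-enumeration (suc n))) ⟩
  suc n * total ascents (suc n) + sum (map (λ _ → suc (suc n)) (enumeration (suc n)))
    ≡⟨ cong (suc n * total ascents (suc n) +_) (sum-const-enumeration (suc n) (suc (suc n))) ⟩
  suc n * total ascents (suc n) + suc (suc n) ! ∎
  where open ≡-Reasoning

total-endsInAscent-suc : ∀ n →
  total endsInAscent (suc (suc n)) + 2 * total endsInAscent (suc n) ≡ suc n * total endsInAscent (suc n) + 2 * suc n !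
total-endsInAscent-suc n = begin
  total endsInAscent (suc (suc n)) + 2 * total endsInAscent (suc n)
    ≡⟨ cong (_+ 2 * total endsInAscent (suc n)) (total-suc endsInAscent (suc n)) ⟩
  sum (map (λ g → insertionSum endsInAscent (suc n) (flatten g)) (enumeration (suc n))) + 2 * total endsInAscent (suc n)
    ≡⟨ sum-map-affine 2 (suc n) (All.map (insertionSum-endsInAscent-↭ _) (flatten-enumeration (suc n))) ⟩
  suc n * total endsInAscent (suc n) + sum (map (λ _ → 2) (enumeration (suc n)))
    ≡⟨ cong (suc n * total endsInAscent (suc n) +_) (sum-const-enumeration (suc n) 2) ⟩
  suc n * total endsInAscent (suc n) + 2 * suc n ! ∎
  where open ≡-Reasoning

endsInAscent-closed-step : ∀ m f B B′ → 3 * B ≡ 2 * f → B′ + 2 * B ≡ (3 + m) * B + 2 * f → 3 * B′ ≡ 2 * ((4 + m) * f)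
endsInAscent-closed-step m f B B′ closed rec = +-cancelʳ-≡ (4 * f) (3 * B′) (2 * ((4 + m) * f)) (begin
  3 * B′ + 4 * f                ≡⟨ cong (3 * B′ +_) (double f) ⟩
  3 * B′ + 2 * (2 * f)          ≡⟨ cong (λ x → 3 * B′ + 2 * x) (sym closed) ⟩
  3 * B′ + 2 * (3 * B)          ≡⟨ factor B B′ ⟩
  3 * (B′ + 2 * B)              ≡⟨ cong (3 *_) rec ⟩
  3 * ((3 + m) * B + 2 * f)     ≡⟨ expand m B f ⟩
  (3 + m) * (3 * B) + 6 * f     ≡⟨ cong (λ x → (3 + m) * x + 6 * f) closed ⟩
  (3 + m) * (2 * f) + 6 * f     ≡⟨ collect m f ⟩
  2 * ((4 + m) * f) + 4 * f     ∎)
  where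
  open ≡-Reasoning
  double : ∀ f → 4 * f ≡ 2 * (2 * f)
  double = solve-∀
  factor : ∀ B B′ → 3 * B′ + 2 * (3 * B) ≡ 3 * (B′ + 2 * B)
  factor = solve-∀
  expand : ∀ m B f → 3 * ((3 + m) * B + 2 * f) ≡ (3 + m) * (3 * B) + 6 * f
  expand = solve-∀
  collect : ∀ m f → (3 + m) * (2 * f) + 6 * f ≡ 2 * ((4 + m) * f) + 4 * f
  collect = solve-∀

ascents-closed-step : ∀ m f A A′ → 2 * A ≡ f * ((2 + m) * (5 + m)) →
  A′ + 0 * A ≡ (3 + m) * A + (4 + m) * ((3 + m) * f) → 2 * A′ ≡ (3 + m) * f * ((3 + m) * (6 + m))
ascents-closed-step m f A A′ closed rec = begin
  2 * A′                                                        ≡⟨ cong (2 *_) (trans (sym (+-identityʳ A′)) rec) ⟩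
  2 * ((3 + m) * A + (4 + m) * ((3 + m) * f))                   ≡⟨ expand m A f ⟩
  (3 + m) * (2 * A) + 2 * ((4 + m) * ((3 + m) * f))             ≡⟨ cong (λ x → (3 + m) * x + 2 * ((4 + m) * ((3 + m) * f))) closed ⟩
  (3 + m) * (f * ((2 + m) * (5 + m))) + 2 * ((4 + m) * ((3 + m) * f)) ≡⟨ collect m f ⟩
  (3 + m) * f * ((3 + m) * (6 + m))                             ∎
  where
  open ≡-Reasoning
  expand : ∀ m A f → 2 * ((3 + m) * A + (4 + m) * ((3 + m) * f)) ≡ (3 + m) * (2 * A) + 2 * ((4 + m) * ((3 + m) * f))
  expand = solve-∀
  collect : ∀ m f → (3 + m) * (f * ((2 + m) * (5 + m))) + 2 * ((4 + m) * ((3 + m) * f)) ≡ (3 + m) * f * ((3 + m) * (6 + m))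
  collect = solve-∀

occ123-closed-step : ∀ m f T T′ A B → 6 * T ≡ f * (m * m + 9 * m + 12) → 2 * A ≡ f * ((2 + m) * (5 + m)) →
  3 * B ≡ 2 * ((3 + m) * f) → T′ + 1 * T ≡ (3 + m) * T + (A + B) →
  6 * T′ ≡ (3 + m) * f * ((1 + m) * (1 + m) + 9 * (1 + m) + 12)
occ123-closed-step m f T T′ A B closedT closedA closedB rec = +-cancelʳ-≡ (f * P) (6 * T′) _ (begin
  6 * T′ + f * P                                      ≡⟨ cong (6 * T′ +_) (sym closedT) ⟩
  6 * T′ + 6 * T                                      ≡⟨ factor T T′ ⟩
  6 * (T′ + 1 * T)                                    ≡⟨ cong (6 *_) rec ⟩
  6 * ((3 + m) * T + (A + B))                         ≡⟨ expand m T A B ⟩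
  (3 + m) * (6 * T) + 3 * (2 * A) + 2 * (3 * B)       ≡⟨ cong₂ (λ x y → (3 + m) * x + 3 * y + 2 * (3 * B)) closedT closedA ⟩
  (3 + m) * (f * P) + 3 * (f * Q) + 2 * (3 * B)       ≡⟨ cong (λ x → (3 + m) * (f * P) + 3 * (f * Q) + 2 * x) closedB ⟩
  (3 + m) * (f * P) + 3 * (f * Q) + 2 * (2 * ((3 + m) * f))
                                                      ≡⟨ collect m f ⟩
  (3 + m) * f * ((1 + m) * (1 + m) + 9 * (1 + m) + 12) + f * P ∎)
  where
  open ≡-Reasoning
  P = m * m + 9 * m + 12
  Q = (2 + m) * (5 + m)
  factor : ∀ T T′ → 6 * T′ + 6 * T ≡ 6 * (T′ + 1 * T)
  factor = solve-∀
  expand : ∀ m T A B → 6 * ((3 + m) * T + (A + B)) ≡ (3 + m) * (6 * T) + 3 * (2 * A) + 2 * (3 * B)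
  expand = solve-∀
  collect : ∀ m f → (3 + m) * (f * (m * m + 9 * m + 12)) + 3 * (f * ((2 + m) * (5 + m))) + 2 * (2 * ((3 + m) * f))
                  ≡ (3 + m) * f * ((1 + m) * (1 + m) + 9 * (1 + m) + 12) + f * (m * m + 9 * m + 12)
  collect = solve-∀

-- Closed forms for n = 3 + m; the case m = 0 is evaluated over the six permutations of [3].
total-endsInAscent-closed : ∀ m → 3 * total endsInAscent (3 + m) ≡ 2 * (3 + m) !
total-endsInAscent-closed zero    = refl
total-endsInAscent-closed (suc m) =
  endsInAscent-closed-step m ((3 + m) !) (total endsInAscent (3 + m)) (total endsInAscent (4 + m))
                           (total-endsInAscent-closed m) (total-endsInAscent-suc (2 + m))

total-ascents-closed : ∀ m → 2 * total ascents (3 + m) ≡ (2 + m) ! * ((2 + m) * (5 + m))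
total-ascents-closed zero    = refl
total-ascents-closed (suc m) =
  ascents-closed-step m ((2 + m) !) (total ascents (3 + m)) (total ascents (4 + m))
                      (total-ascents-closed m) (total-ascents-suc (2 + m))

-- m * m + 9 * m + 12 is n * n + 3 * n - 6 at n = 3 + m
total-occ123-closed : ∀ m → 6 * total occ123 (3 + m) ≡ (2 + m) ! * (m * m + 9 * m + 12)
total-occ123-closed zero    = refl
total-occ123-closed (suc m) =
  occ123-closed-step m ((2 + m) !) (total occ123 (3 + m)) (total occ123 (4 + m)) (total ascents (3 + m)) (total endsInAscent (3 + m))
                     (total-occ123-closed m) (total-ascents-closed m) (total-endsInAscent-closed m)
                     (total-occ123-suc (3 + m))

module _ {n : ℕ} {L : List (Permutation′ n)} (L-enum : IsEnumeration n L) where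

  total123≡total : total123 L ≡ total occ123 n
  total123≡total = sum-map-enumeration (occ123 ∘ flatten) (λ {π} {σ} π≈σ → cong occ123 (flatten-cong {π = π} {σ} π≈σ))
                                       L-enum (enumeration-isEnumeration n)

  length-isEnumeration : length L ≡ n !
  length-isEnumeration = begin
    length L                                  ≡⟨ length≡sum-map-1 L ⟩
    sum (map (λ _ → 1) L)                     ≡⟨ sum-map-enumeration (λ _ → 1) (λ _ → refl) L-enum (enumeration-isEnumeration n) ⟩
    sum (map (λ _ → 1) (enumeration n))       ≡⟨ length≡sum-map-1 (enumeration n) ⟨
    length (enumeration n)                    ≡⟨ length-enumeration n ⟩
    n !                                       ∎
    where open ≡-Reasoning

corollary3p6 : (n : ℕ) → 3 ≤ n → (L : List (Permutation′ n)) → IsEnumeration n L →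
  6 * n * total123 L ≡ length L * (n * n + 3 * n ∸ 6)
corollary3p6 (suc (suc (suc m))) (s≤s (s≤s (s≤s z≤n))) L L-enum = begin
  6 * (3 + m) * total123 L                          ≡⟨ cong (6 * (3 + m) *_) (total123≡total L-enum) ⟩
  6 * (3 + m) * total occ123 (3 + m)                ≡⟨ *-comm-middle 6 (3 + m) (total occ123 (3 + m)) ⟩
  (3 + m) * (6 * total occ123 (3 + m))              ≡⟨ cong ((3 + m) *_) (total-occ123-closed m) ⟩
  (3 + m) * ((2 + m) ! * (m * m + 9 * m + 12))      ≡⟨ *-assoc (3 + m) ((2 + m) !) _ ⟨
  (3 + m) ! * (m * m + 9 * m + 12)                  ≡⟨ cong₂ _*_ (length-isEnumeration L-enum) polynomial ⟨
  length L * ((3 + m) * (3 + m) + 3 * (3 + m) ∸ 6)  ∎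
  where
  open ≡-Reasoning
  *-comm-middle : ∀ a b c → a * b * c ≡ b * (a * c)
  *-comm-middle = solve-∀
  polynomial : (3 + m) * (3 + m) + 3 * (3 + m) ∸ 6 ≡ m * m + 9 * m + 12
  polynomial = trans (cong (_∸ 6) (expand m)) (m+n∸m≡n 6 (m * m + 9 * m + 12))
    where
    expand : ∀ m → (3 + m) * (3 + m) + 3 * (3 + m) ≡ 6 + (m * m + 9 * m + 12)
    expand = solve-∀
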